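{- For every integer $n\ge 1$, let $\rho_n$ be the number of distinct Manacher arrays of strings of length $n$, and let $r_{n+1}$ be the number of rooted duplication trees with $n+1$ leaves. Then $\rho_n \le r_{n+1}$.
   Context: Strings are finite sequences over an arbitrary alphabet; $S[i..j]=S[i]S[i+1]\cdots S[j]$ and a palindrome is a string equal to its reversal. The Manacher array of a string $S$ of length $n$ is the array $\mathsf A[1..2n-1]$ where, for $i=2k-1$, $\mathsf A[i]$ is the largest $r\ge 0$ with $1\le k-r\le k+r\le n$ such that $S[k-r..k+r]$ is a palindrome, and for $i=2k$, $\mathsf A[i]$ is the largest $r\ge 0$ with $1\le k-r+1\le k+r\le n$ such that $S[k-r+1..k+r]$ is a palindrome. $\rho_n$ counts the distinct arrays that arise as Manacher arrays of strings of length $n$ (over any alphabet). Tandem duplication event: given an ordered sequence of genes $(g_1,\dots,g_m)$ and a contiguous block of indices $B=\{i,\dots,i+\ell-1\}$ with $1\le i\le i+\ell-1\le m$, the event replaces $g_i,\dots,g_{i+\ell-1}$ by $\operatorname{lc}(g_i),\dots,\operatorname{lc}(g_{i+\ell-1}),\operatorname{rc}(g_i),\dots,\operatorname{rc}(g_{i+\ell-1})$, where the $\operatorname{lc}(g_j),\operatorname{rc}(g_j)$ are distinct new genes, which become the left and right child of $g_j$. A rooted duplication tree is obtained by starting from the single gene sequence $(1)$ (the root) and applying a finite sequence of duplication events; the tree records the history: the root is the ancestral gene, each duplicated gene is an internal node with left child $\operatorname{lc}$ and right child $\operatorname{rc}$, and the leaves are the genes of the final sequence, carrying the left-to-right order of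 that final sequence. Two such trees are identified if they are isomorphic as rooted binary trees with distinguished left/right children and with the same left-to-right order of leaves. $r_n$ is the number of distinct rooted duplication trees with $n$ leaves (known to satisfy $r_1=r_2=1$ and $r_n=\sum_{k=1}^{\lfloor (n+1)/3\rfloor}(-1)^{k+1}\binom{n+1-2k}{k}r_{n-k}$ for $n\ge 3$). -}

module Defs where

open import Data.Nat using (ℕ; zero; suc; _+_; _*_; _∸_; _≤_; _<_)
open import Data.Bool using (Bool; true; false)
open import Data.List using (List; []; _∷_; _++_; map; take; drop; reverse; length)
open import Data.List.Membership.Propositional using (_∈_)
open import Data.List.Relation.Unary.Unique.Propositional using (Unique)
open import Data.Maybe using (Maybe; just; nothing)
open import Data.Product using (Σ; _×_)
open import Level using (Level; _⊔_) renaming (suc to lsuc)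
open import Relation.Binary.PropositionalEquality using (_≡_)

-- S[a..b] with 1-based indices (empty when b < a)
slice : {A : Set} → List A → ℕ → ℕ → List A
slice S a b = take (suc b ∸ a) (drop (a ∸ 1) S)

IsPalindrome : {A : Set} → List A → Set
IsPalindrome w = reverse w ≡ w

-- r is admissible at odd position i = 2k-1:  1 ≤ k-r, k+r ≤ n, S[k-r..k+r] palindrome
OddOK : {A : Set} → List A → ℕ → ℕ → Set
OddOK S k r = (r < k) × (k + r ≤ length S) × IsPalindrome (slice S (k ∸ r) (k + r))

-- r is admissible at even position i = 2k:  1 ≤ k-r+1, k+r ≤ n, S[k-r+1..k+r] palindrome
EvenOK : {A : Set} → List A → ℕ → ℕ → Set
EvenOK S k r = (r ≤ k) × (k + r ≤ length S) × IsPalindrome (slice S (suc k ∸ r) (k + r))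

IsLargest : (ℕ → Set) → ℕ → Set
IsLargest P r = P r × ((r' : ℕ) → P r' → r' ≤ r)

-- 1-based lookup in an array
at : List ℕ → ℕ → Maybe ℕ
at [] _ = nothing
at (x ∷ xs) zero = nothing
at (x ∷ xs) (suc zero) = just x
at (x ∷ xs) (suc (suc i)) = at xs (suc i)

IsManacherArrayOf : {A : Set} → List A → List ℕ → Set
IsManacherArrayOf S M =
  (length M ≡ 2 * length S ∸ 1)
  × ((k : ℕ) → 1 ≤ k → k ≤ length S →
       Σ ℕ λ r → (at M (2 * k ∸ 1) ≡ just r) × IsLargest (OddOK S k) r)
  × ((k : ℕ) → 1 ≤ k → k < length S →
       Σ ℕ λ r → (at M (2 * k) ≡ just r) × IsLargest (EvenOK S k) r)

IsManacherArray : ℕ → List ℕ → Set₁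
IsManacherArray n M =
  Σ Set λ A → Σ (List A) λ S → (length S ≡ n) × IsManacherArrayOf S M

-- A gene is identified with its root-to-node path (false = left child,
-- true = right child); a duplication tree is identified with the final
-- left-to-right sequence of its leaves (as paths).

Gene : Set
Gene = List Bool

lc rc : Gene → Gene
lc g = g ++ (false ∷ [])
rc g = g ++ (true ∷ [])

data Reachable : List Gene → Set where
  root : Reachable ([] ∷ [])
  dup  : (pre : List Gene) (g : Gene) (gs suf : List Gene) →
         Reachable (pre ++ (g ∷ gs) ++ suf) →
         Reachable (pre ++ map lc (g ∷ gs) ++ map rc (g ∷ gs) ++ suf)

IsDuplicationTree : ℕ → List Gene → Set
IsDuplicationTree n L = Reachable L × (length L ≡ n)

HasSize : {ℓ : Level} {X : Set} → (X → Set ℓ) → ℕ → Set ℓ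
HasSize {X = X} P k =
  Σ (List X) λ xs → Unique xs × (length xs ≡ k)
    × ((x : X) → (P x → x ∈ xs) × (x ∈ xs → P x))

{-# OPTIONS --safe #-}
-- Let q_t be the start of the longest palindromic suffix of S[0..t].  The sequence q_1, …, q_{n-1}
-- determines which factors of S are palindromes, hence the Manacher array: a factor ending at t
-- is not a palindrome if it starts before q_t, and if it starts after q_t it is the mirror image,
-- inside the palindrome S[q_t..t], of a factor ending earlier.  Such sequences satisfy q_t ≤ t and
-- q_{t-1} ≤ q_t + 1, and they are encoded injectively as duplication histories with n + 1 leaves:
-- starting from the root with its duplication pending, each q_t either grows the pending block by
-- one gene to the left (if q_t + 1 = q_{t-1}) or performs the pending duplication and opens a new
-- one on the gene at position q_t.  Every step adds one leaf, and the pending duplication always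
-- shows as the rightmost tandem of the leaves, so the history can be read back.
module Submission where

open import Defs
open import Data.Bool using (Bool; true; false)
import Data.Bool.Properties as Bool
open import Data.Empty using (⊥-elim)
open import Data.Fin using (Fin; toℕ) renaming (zero to fzero; suc to fsuc)
open import Data.Fin.Properties using (toℕ-injective; toℕ<n)
import Data.Fin.Properties as Fin
open import Data.List
  using (List; []; _∷_; _++_; _∷ʳ_; map; concatMap; filter; deduplicate; length; reverse; take; drop;
         applyUpTo; upTo; cartesianProductWith; lookup; allFin; tabulate)
open import Data.List.Properties
  using (∷-injective; ∷-injectiveˡ; ∷-injectiveʳ; ∷ʳ-injectiveˡ; ∷ʳ-injectiveʳ; ++-assoc; ++-identityʳ; ++-cancelˡ;
         ++-conicalˡ; length-++; length-++-≤ʳ; length-map; length-reverse; length-take; length-drop; length-applyUpTo;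
         length-tabulate; map-injective; map-tabulate; tabulate-lookup; reverse-involutive; reverse-injective;
         reverse-map; reverse-++; unfold-reverse; take++drop≡id; take-map; drop-map; take-[]; take-all; drop-all;
         take-take; drop-drop; ≡-dec)
open import Data.List.Membership.Propositional using (_∈_; lose; find)
open import Data.List.Membership.Propositional.Properties
  using (∈-map⁺; ∈-map⁻; ∈-++⁺ˡ; ∈-++⁺ʳ; ∈-++⁻; ∈-∃++; ∈-concatMap⁺; ∈-concatMap⁻; ∈-filter⁺; ∈-filter⁻;
         ∈-deduplicate⁺; ∈-deduplicate⁻; ∈-cartesianProductWith⁺; ∈-cartesianProductWith⁻; ∈-upTo⁺)
open import Data.List.Relation.Unary.All using (All; []; _∷_)
import Data.List.Relation.Unary.All as All
import Data.List.Relation.Unary.All.Properties as All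
open import Data.List.Relation.Unary.AllPairs using ([]; _∷_)
open import Data.List.Relation.Unary.Any using (here; there)
open import Data.List.Relation.Unary.Unique.Propositional using (Unique)
open import Data.List.Relation.Unary.Unique.DecPropositional.Properties using (deduplicate-!)
open import Data.Maybe using (Maybe; just; nothing)
import Data.Maybe as Maybe
open import Data.Maybe.Properties using (just-injective)
open import Data.Nat using (ℕ; zero; suc; _+_; _*_; _∸_; _⊓_; _≤_; _<_; z≤n; s≤s; s≤s⁻¹; _≟_; _≤?_; _<?_)
open import Data.Nat.Properties
open import Data.Nat.Solver using (module +-*-Solver)
open import Data.Product using (Σ; ∃; _×_; _,_; proj₁; proj₂; map₁; map₂)
open import Data.Sum using (_⊎_; inj₁; inj₂)
import Data.Sum as Sum
open import Data.Unit using (⊤)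
open import Effect.Monad using (RawMonad)
open import Function using (_∘_)
open import Function.Bundles using (_⇔_; mk⇔; Equivalence)
import Function.Properties.Equivalence as ⇔
open import Relation.Binary.Definitions using (DecidableEquality; tri<; tri≈; tri>)
open import Relation.Binary.PropositionalEquality
open import Relation.Nullary using (¬_; Dec; yes; no)
open import Relation.Nullary.Decidable using (_×-dec_; ¬¬-excluded-middle; decidable-stable)
open import Relation.Nullary.Negation using (¬¬-Monad; ¬¬-map)
open import Relation.Unary using (Decidable)
open import Data.List.Membership.DecPropositional (≡-dec _≟_) using (_∈?_)
open Equivalence using (to; from)
open +-*-Solver using (solve; _:+_; _:=_; con)

private
  variable
    A C : Set

nth : List A → ℕ → Maybe A
nth []       _       = nothing
nth (x ∷ xs) zero    = just x
nth (x ∷ xs) (suc i) = nth xs i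

nth-++ˡ : ∀ (xs : List A) {ys i} → i < length xs → nth (xs ++ ys) i ≡ nth xs i
nth-++ˡ (x ∷ xs) {i = zero}  _       = refl
nth-++ˡ (x ∷ xs) {i = suc i} (s≤s p) = nth-++ˡ xs p

nth-++ʳ : ∀ (xs : List A) {ys m} i → length xs ≡ m → nth (xs ++ ys) (m + i) ≡ nth ys i
nth-++ʳ []       i refl = refl
nth-++ʳ (x ∷ xs) i refl = nth-++ʳ xs i refl

nth-map : ∀ (f : A → C) xs i → nth (map f xs) i ≡ Maybe.map f (nth xs i)
nth-map f []       i       = refl
nth-map f (x ∷ xs) zero    = refl
nth-map f (x ∷ xs) (suc i) = nth-map f xs i

nth-<-length : ∀ (xs : List A) {i} → i < length xs → ∃ λ x → nth xs i ≡ just x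
nth-<-length (x ∷ xs) {zero}  _       = x , refl
nth-<-length (x ∷ xs) {suc i} (s≤s p) = nth-<-length xs p

nth-just⇒< : ∀ (xs : List A) {i x} → nth xs i ≡ just x → i < length xs
nth-just⇒< (y ∷ xs) {zero}  _ = s≤s z≤n
nth-just⇒< (y ∷ xs) {suc i} e = s≤s (nth-just⇒< xs e)

map-≡-just : ∀ {f : A → C} {m y} → Maybe.map f m ≡ just y → ∃ λ x → m ≡ just x × y ≡ f x
map-≡-just {m = just x} refl = x , refl , refl

++-cancel-≡-length : ∀ (xs xs′ : List A) {ys ys′} → length xs ≡ length xs′ →
                     xs ++ ys ≡ xs′ ++ ys′ → xs ≡ xs′ × ys ≡ ys′
++-cancel-≡-length []       []         _ e = refl , e
++-cancel-≡-length (x ∷ xs) (x′ ∷ xs′) l e with ∷-injective e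
... | refl , e′ = map₁ (cong (x ∷_)) (++-cancel-≡-length xs xs′ (suc-injective l) e′)

infix 4 _⊑_

_⊑_ : List A → List A → Set
xs ⊑ ys = ∃ λ zs → xs ++ zs ≡ ys

⊑-refl : (xs : List A) → xs ⊑ xs
⊑-refl xs = [] , ++-identityʳ xs

⊑-++ : ∀ (xs : List A) {ys zs} → xs ++ ys ⊑ zs → xs ⊑ zs
⊑-++ xs {ys} (ws , e) = ys ++ ws , trans (sym (++-assoc xs ys ws)) e

⊑-cancelˡ : ∀ (xs : List A) {ys zs} → xs ++ ys ⊑ xs ++ zs → ys ⊑ zs
⊑-cancelˡ xs {ys} (ws , e) = ws , ++-cancelˡ xs _ _ (trans (sym (++-assoc xs ys ws)) e)

⊑-∷ʳ : ∀ (xs ys : List A) {y} → xs ⊑ ys ∷ʳ y → xs ⊑ ys ⊎ xs ≡ ys ∷ʳ y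
⊑-∷ʳ []       ys       _        = inj₁ (ys , refl)
⊑-∷ʳ (x ∷ xs) []       (zs , e) = inj₂ (cong₂ _∷_ (∷-injectiveˡ e) (++-conicalˡ xs zs (∷-injectiveʳ e)))
⊑-∷ʳ (x ∷ xs) (y ∷ ys) (zs , e) with ∷-injective e
... | refl , e′ = Sum.map (λ (ws , e″) → ws , cong (x ∷_) e″) (cong (x ∷_)) (⊑-∷ʳ xs ys (zs , e′))

lc≢rc : ∀ g h → lc g ≢ rc h
lc≢rc g h e with ∷ʳ-injectiveʳ g h e
... | ()

lc-injective : ∀ {g h} → lc g ≡ lc h → g ≡ h
lc-injective {g} {h} = ∷ʳ-injectiveˡ g h

-- Duplicating a block

before after : List Gene → List Gene → List Gene → List Gene
before P B S = P ++ B ++ S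
after  P B S = P ++ map lc B ++ map rc B ++ S

data Offset (a : ℕ) : ℕ → Set where
  below : ∀ {i} → i < a → Offset a i
  above : ∀ u → Offset a (a + u)

offset : ∀ a i → Offset a i
offset zero    i       = above i
offset (suc a) zero    = below (s≤s z≤n)
offset (suc a) (suc i) with offset a i
... | below p = below (s≤s p)
... | above u = above u

data Region (a l : ℕ) : ℕ → Set where
  inPrefix : ∀ {i} → i < a → Region a l i
  inLeft   : ∀ u → u < l → Region a l (a + u)
  inRight  : ∀ u → u < l → Region a l (a + (l + u))
  inSuffix : ∀ u → Region a l (a + (l + (l + u)))

region : ∀ a l i → Region a l i
region a l i with offset a i
... | below p = inPrefix p
... | above v with offset l v
...   | below p = inLeft v p
...   | above w with offset l w
...     | below p = inRight w p
...     | above u = inSuffix u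

module _ (P B S : List Gene) where

  private
    a l : ℕ
    a = length P
    l = length B

  nth-before-block : ∀ u → u < l → nth (before P B S) (a + u) ≡ nth B u
  nth-before-block u p = trans (nth-++ʳ P u refl) (nth-++ˡ B p)

  nth-after-pre : ∀ {i} → i < a → nth (after P B S) i ≡ nth (before P B S) i
  nth-after-pre p = trans (nth-++ˡ P p) (sym (nth-++ˡ P p))

  nth-after-left : ∀ u → u < l → nth (after P B S) (a + u) ≡ Maybe.map lc (nth B u)
  nth-after-left u p = begin
    nth (after P B S) (a + u)               ≡⟨ nth-++ʳ P u refl ⟩
    nth (map lc B ++ map rc B ++ S) u       ≡⟨ nth-++ˡ (map lc B) (subst (u <_) (sym (length-map lc B)) p) ⟩
    nth (map lc B) u                        ≡⟨ nth-map lc B u ⟩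
    Maybe.map lc (nth B u)                  ∎
    where open ≡-Reasoning

  nth-after-right : ∀ u → u < l → nth (after P B S) (a + (l + u)) ≡ Maybe.map rc (nth B u)
  nth-after-right u p = begin
    nth (after P B S) (a + (l + u))         ≡⟨ nth-++ʳ P (l + u) refl ⟩
    nth (map lc B ++ map rc B ++ S) (l + u) ≡⟨ nth-++ʳ (map lc B) u (length-map lc B) ⟩
    nth (map rc B ++ S) u                   ≡⟨ nth-++ˡ (map rc B) (subst (u <_) (sym (length-map rc B)) p) ⟩
    nth (map rc B) u                        ≡⟨ nth-map rc B u ⟩
    Maybe.map rc (nth B u)                  ∎
    where open ≡-Reasoning

  nth-after-suf : ∀ u → nth (after P B S) (a + (l + (l + u))) ≡ nth (before P B S) (a + (l + u))
  nth-after-suf u = begin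
    nth (after P B S) (a + (l + (l + u)))         ≡⟨ nth-++ʳ P (l + (l + u)) refl ⟩
    nth (map lc B ++ map rc B ++ S) (l + (l + u)) ≡⟨ nth-++ʳ (map lc B) (l + u) (length-map lc B) ⟩
    nth (map rc B ++ S) (l + u)                   ≡⟨ nth-++ʳ (map rc B) u (length-map rc B) ⟩
    nth S u                                       ≡⟨ sym (nth-++ʳ B u refl) ⟩
    nth (B ++ S) (l + u)                          ≡⟨ sym (nth-++ʳ P (l + u) refl) ⟩
    nth (before P B S) (a + (l + u))              ∎
    where open ≡-Reasoning

  origin : ∀ {i} → Region a l i → ℕ
  origin {i} (inPrefix _) = i
  origin (inLeft u _)     = a + u
  origin (inRight u _)    = a + u
  origin (inSuffix u)     = a + (l + u)

  mark : ∀ {i} → Region a l i → List Bool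
  mark (inPrefix _)  = []
  mark (inLeft _ _)  = false ∷ []
  mark (inRight _ _) = true ∷ []
  mark (inSuffix _)  = []

  mark-short : ∀ {i} (r : Region a l i) → mark r ≡ [] ⊎ ∃ λ b → mark r ≡ b ∷ []
  mark-short (inPrefix _)  = inj₁ refl
  mark-short (inLeft _ _)  = inj₂ (false , refl)
  mark-short (inRight _ _) = inj₂ (true , refl)
  mark-short (inSuffix _)  = inj₁ refl

  nth-after-origin : ∀ {i x} (r : Region a l i) → nth (after P B S) i ≡ just x →
                     ∃ λ g → nth (before P B S) (origin r) ≡ just g × x ≡ g ++ mark r
  nth-after-origin (inPrefix p) e = _ , trans (sym (nth-after-pre p)) e , sym (++-identityʳ _)
  nth-after-origin (inLeft u p) e with map-≡-just {f = lc} (trans (sym (nth-after-left u p)) e)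
  ... | g , eg , refl = g , trans (nth-before-block u p) eg , refl
  nth-after-origin (inRight u p) e with map-≡-just {f = rc} (trans (sym (nth-after-right u p)) e)
  ... | g , eg , refl = g , trans (nth-before-block u p) eg , refl
  nth-after-origin (inSuffix u) e = _ , trans (sym (nth-after-suf u)) e , sym (++-identityʳ _)

  private
    pre≢block : ∀ {i u} → i < a → i ≢ a + u
    pre≢block {u = u} p e = <⇒≱ p (subst (a ≤_) (sym e) (m≤m+n a u))

    block≢suf : ∀ {u u′} → u < l → a + u ≢ a + (l + u′)
    block≢suf {u′ = u′} p e = <⇒≱ p (subst (l ≤_) (sym (+-cancelˡ-≡ a _ _ e)) (m≤m+n l u′))

    false⋢true : ¬ (false ∷ []) ⊑ (true ∷ [])
    false⋢true (_ , ())

    true⋢false : ¬ (true ∷ []) ⊑ (false ∷ [])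
    true⋢false (_ , ())

  region-injective : ∀ {i j} (r : Region a l i) (r′ : Region a l j) →
                     origin r ≡ origin r′ → mark r ⊑ mark r′ → i ≡ j
  region-injective (inPrefix p)  (inPrefix _)     e _ = e
  region-injective (inPrefix p)  (inLeft _ _)     e _ = ⊥-elim (pre≢block p e)
  region-injective (inPrefix p)  (inRight _ _)    e _ = ⊥-elim (pre≢block p e)
  region-injective (inPrefix p)  (inSuffix _)     e _ = ⊥-elim (pre≢block p e)
  region-injective (inLeft _ _)  (inPrefix p′)    e _ = ⊥-elim (pre≢block p′ (sym e))
  region-injective (inLeft _ _)  (inLeft _ _)     e _ = e
  region-injective (inLeft _ _)  (inRight _ _)    _ t = ⊥-elim (false⋢true t)
  region-injective (inLeft _ p)  (inSuffix _)     e _ = ⊥-elim (block≢suf p e)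
  region-injective (inRight _ _) (inPrefix p′)    e _ = ⊥-elim (pre≢block p′ (sym e))
  region-injective (inRight _ _) (inLeft _ _)     _ t = ⊥-elim (true⋢false t)
  region-injective (inRight _ _) (inRight _ _)    e _ = cong (λ v → a + (l + v)) (+-cancelˡ-≡ a _ _ e)
  region-injective (inRight _ p) (inSuffix _)     e _ = ⊥-elim (block≢suf p e)
  region-injective (inSuffix _)  (inPrefix p′)    e _ = ⊥-elim (pre≢block p′ (sym e))
  region-injective (inSuffix _)  (inLeft _ p′)    e _ = ⊥-elim (block≢suf p′ (sym e))
  region-injective (inSuffix _)  (inRight _ p′)   e _ = ⊥-elim (block≢suf p′ (sym e))
  region-injective (inSuffix _)  (inSuffix _)     e _ = cong (λ v → a + (l + (l + v))) (+-cancelˡ-≡ l _ _ (+-cancelˡ-≡ a _ _ e))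

PrefixFree : List Gene → Set
PrefixFree F = ∀ {i j x y} → nth F i ≡ just x → nth F j ≡ just y → x ⊑ y → i ≡ j

⊑-comparable : ∀ (g h : Gene) {t t′} → t′ ≡ [] ⊎ (∃ λ b → t′ ≡ b ∷ []) →
               g ++ t ⊑ h ++ t′ → g ⊑ h ⊎ h ⊑ g
⊑-comparable g h (inj₁ refl)       q = inj₁ (⊑-++ g (subst (_ ⊑_) (++-identityʳ h) q))
⊑-comparable g h (inj₂ (b , refl)) q = Sum.map₂ (λ e → b ∷ [] , sym e) (⊑-∷ʳ g h (⊑-++ g q))

prefixFree-after : ∀ P B S → PrefixFree (before P B S) → PrefixFree (after P B S)
prefixFree-after P B S pf {i} {j} ei ej q
  with region (length P) (length B) i | region (length P) (length B) j
... | ri | rj with nth-after-origin P B S ri ei | nth-after-origin P B S rj ej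
... | g , eg , refl | h , eh , refl =
  region-injective P B S ri rj same-origin (⊑-cancelˡ h (subst (λ k → k ++ mark P B S ri ⊑ _) g≡h q))
  where
    same-origin : origin P B S ri ≡ origin P B S rj
    same-origin = Sum.[ pf eg eh , (λ h⊑g → sym (pf eh eg h⊑g)) ] (⊑-comparable g h (mark-short P B S rj) q)
    g≡h : g ≡ h
    g≡h = just-injective (trans (sym eg) (trans (cong (nth (before P B S)) same-origin) eh))

prefixFree-distinct : ∀ {F i j x} → PrefixFree F → nth F i ≡ just x → nth F j ≡ just x → i ≡ j
prefixFree-distinct pf eᵢ eⱼ = pf eᵢ eⱼ (⊑-refl _)

record Tandem (F : List Gene) (c k : ℕ) : Set where
  constructor tandem
  field
    nonempty : 1 ≤ k
    copies   : ∀ j → j < k → ∃ λ x → nth F (c + j) ≡ just (lc x) × nth F (c + k + j) ≡ just (rc x)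

TandemsBefore : List Gene → ℕ → Set
TandemsBefore F m = ∀ {c k} → Tandem F c k → c < m

tandem-head : ∀ {F c k} → Tandem F c k → ∃ λ x → nth F c ≡ just (lc x) × nth F (c + k) ≡ just (rc x)
tandem-head {F} {c} {k} (tandem k≥1 t) with t 0 k≥1
... | x , e , e′ = x , subst (λ i → nth F i ≡ just (lc x)) (+-identityʳ c) e
                     , subst (λ i → nth F i ≡ just (rc x)) (+-identityʳ (c + k)) e′

private
  shift₁ : ∀ a l u v → a + (l + u) + v ≡ a + (l + (u + v))
  shift₁ = solve 4 (λ a l u v → a :+ (l :+ u) :+ v := a :+ (l :+ (u :+ v))) refl

  shift₂ : ∀ a l u v → a + (l + (l + u)) + v ≡ a + (l + (l + (u + v)))
  shift₂ = solve 4 (λ a l u v → a :+ (l :+ (l :+ u)) :+ v := a :+ (l :+ (l :+ (u :+ v)))) refl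

module _ (P B S : List Gene) where

  private
    a l : ℕ
    a = length P
    l = length B

  left≢rc : ∀ {u x} → u < l → nth (after P B S) (a + u) ≢ just (rc x)
  left≢rc {u} p e with nth-<-length B p
  ... | g , eg = lc≢rc _ _ (just-injective (trans (sym (trans (nth-after-left P B S u p) (cong (Maybe.map lc) eg))) e))

  right≢lc : ∀ {u x} → u < l → nth (after P B S) (a + (l + u)) ≢ just (lc x)
  right≢lc {u} p e with nth-<-length B p
  ... | g , eg = lc≢rc _ _ (just-injective (trans (sym e) (trans (nth-after-right P B S u p) (cong (Maybe.map rc) eg))))

  block-tandem : 1 ≤ l → Tandem (after P B S) a l
  block-tandem l≥1 = tandem l≥1 λ j p → let (g , eg) = nth-<-length B p in
    g , trans (nth-after-left P B S j p) (cong (Maybe.map lc) eg)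
      , trans (cong (nth (after P B S)) (+-assoc a l j)) (trans (nth-after-right P B S j p) (cong (Maybe.map rc) eg))

  nth-after-suf+ : ∀ u v → nth (after P B S) (a + (l + (l + u)) + v) ≡ nth (before P B S) (a + (l + u) + v)
  nth-after-suf+ u v = begin
    nth (after P B S) (a + (l + (l + u)) + v)   ≡⟨ cong (nth (after P B S)) (shift₂ a l u v) ⟩
    nth (after P B S) (a + (l + (l + (u + v)))) ≡⟨ nth-after-suf P B S (u + v) ⟩
    nth (before P B S) (a + (l + (u + v)))      ≡⟨ cong (nth (before P B S)) (sym (shift₁ a l u v)) ⟩
    nth (before P B S) (a + (l + u) + v)        ∎
    where open ≡-Reasoning

  tandem-after-suf : ∀ u {k} → Tandem (after P B S) (a + (l + (l + u))) k → Tandem (before P B S) (a + (l + u)) k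
  tandem-after-suf u {k} (tandem k≥1 t) = tandem k≥1 λ j p → let (x , e , e′) = t j p in
    x , trans (sym (nth-after-suf+ u j)) e
      , trans (cong (nth (before P B S)) (+-assoc (a + (l + u)) k j))
          (trans (sym (nth-after-suf+ u (k + j))) (trans (cong (nth (after P B S)) (sym (+-assoc _ k j))) e′))

  -- A tandem starting at a + u + 1 must have length l, since its first right copy rc B[u+1]
  -- occurs only once; then its left half covers position a + l, which holds rc B[0].
  no-tandem-inside-block : PrefixFree (after P B S) → ∀ u {k} → suc u < l → ¬ Tandem (after P B S) (a + suc u) k
  no-tandem-inside-block pf u {k} p T@(tandem _ t) with tandem-head T | nth-<-length B p | m≤n⇒∃[o]m+o≡n (<⇒≤ p)
  ... | x , ex , ex′ | g , eg | j , u+j≡l = right≢lc {u = 0} (≤-trans (s≤s z≤n) p) lc-at-a+l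
    where
      x≡g : x ≡ g
      x≡g = lc-injective (just-injective (trans (sym ex) (trans (nth-after-left P B S (suc u) p) (cong (Maybe.map lc) eg))))
      rc-g : nth (after P B S) (a + (l + suc u)) ≡ just (rc x)
      rc-g = trans (nth-after-right P B S (suc u) p) (cong (Maybe.map rc) (trans eg (cong just (sym x≡g))))
      k≡l : k ≡ l
      k≡l = +-cancelˡ-≡ (suc u) _ _ (+-cancelˡ-≡ a _ _
              (trans (sym (+-assoc a (suc u) k)) (trans (prefixFree-distinct {after P B S} pf ex′ rc-g) (cong (a +_) (+-comm l (suc u))))))
      j<k : j < k
      j<k = subst (j <_) (trans u+j≡l (sym k≡l)) (s≤s (m≤n+m j u))
      lc-at-a+l : nth (after P B S) (a + (l + 0)) ≡ just (lc (proj₁ (t j j<k)))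
      lc-at-a+l = trans (cong (nth (after P B S)) (trans (cong (a +_) (trans (+-identityʳ l) (sym u+j≡l))) (sym (+-assoc a (suc u) j))))
                        (proj₁ (proj₂ (t j j<k)))

  tandems-after : PrefixFree (after P B S) → TandemsBefore (before P B S) (a + l) →
                  ∀ {c k} → Tandem (after P B S) c k → c ≤ a
  tandems-after pf early {c} T with region a l c
  ... | inPrefix p       = <⇒≤ p
  ... | inLeft zero _    = ≤-reflexive (+-identityʳ a)
  ... | inLeft (suc u) p = ⊥-elim (no-tandem-inside-block pf u p T)
  ... | inRight u p      = ⊥-elim (right≢lc p (proj₁ (proj₂ (tandem-head T))))
  ... | inSuffix u       = ⊥-elim (<⇒≱ (early (tandem-after-suf u T)) (+-monoʳ-≤ a (m≤m+n l u)))

after-injective : ∀ {P B S P′ B′ S′} → 1 ≤ length B → 1 ≤ length B′ → PrefixFree (after P B S) →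
                  TandemsBefore (before P B S) (length P + length B) →
                  TandemsBefore (before P′ B′ S′) (length P′ + length B′) →
                  after P B S ≡ after P′ B′ S′ → P ≡ P′ × B ≡ B′ × S ≡ S′
after-injective {P} {B} {S} {P′} {B′} {S′} B≥1 B′≥1 pf early early′ eq = P≡P′ , B≡B′ , S≡S′
  where
    |P|≡|P′| : length P ≡ length P′
    |P|≡|P′| = ≤-antisym
      (tandems-after P′ B′ S′ (subst PrefixFree eq pf) early′ (subst (λ F → Tandem F _ _) eq (block-tandem P B S B≥1)))
      (tandems-after P B S pf early (subst (λ F → Tandem F _ _) (sym eq) (block-tandem P′ B′ S′ B′≥1)))
    T′ : Tandem (after P B S) (length P) (length B′)
    T′ = subst₂ (λ F c → Tandem F c (length B′)) (sym eq) (sym |P|≡|P′|) (block-tandem P′ B′ S′ B′≥1)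
    |B|≡|B′| : length B ≡ length B′
    |B|≡|B′| with <-cmp (length B) (length B′)
    ... | tri≈ _ e _ = e
    ... | tri< p _ _ = ⊥-elim (right≢lc P B S B≥1
          (trans (cong (λ i → nth (after P B S) (length P + i)) (+-identityʳ (length B)))
                 (proj₁ (proj₂ (Tandem.copies T′ (length B) p)))))
    ... | tri> _ _ p = ⊥-elim (left≢rc P B S p (proj₂ (proj₂ (tandem-head T′))))
    split-P : P ≡ P′ × map lc B ++ map rc B ++ S ≡ map lc B′ ++ map rc B′ ++ S′
    split-P = ++-cancel-≡-length P P′ |P|≡|P′| eq
    P≡P′ : P ≡ P′
    P≡P′ = proj₁ split-P
    split-B : map lc B ≡ map lc B′ × map rc B ++ S ≡ map rc B′ ++ S′
    split-B = ++-cancel-≡-length (map lc B) (map lc B′)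
                (trans (length-map lc B) (trans |B|≡|B′| (sym (length-map lc B′)))) (proj₂ split-P)
    B≡B′ : B ≡ B′
    B≡B′ = map-injective lc-injective (proj₁ split-B)
    S≡S′ : S ≡ S′
    S≡S′ = ++-cancelˡ (map rc B′) S S′ (subst (λ X → map rc X ++ S ≡ map rc B′ ++ S′) B≡B′ (proj₂ split-B))

length-map-++ : ∀ (f : A → C) xs {ys} → length (map f xs ++ ys) ≡ length xs + length ys
length-map-++ f xs {ys} = trans (length-++ (map f xs)) (cong (_+ length ys) (length-map f xs))

length-after : ∀ P B S → length (after P B S) ≡ length (before P B S) + length B
length-after P B S = begin
  length (after P B S)                           ≡⟨ length-++ P ⟩
  length P + length (map lc B ++ map rc B ++ S)  ≡⟨ cong (length P +_) (trans (length-map-++ lc B) (cong (length B +_) (length-map-++ rc B))) ⟩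
  length P + (length B + (length B + length S))  ≡⟨ solve 3 (λ p b s → p :+ (b :+ (b :+ s)) := p :+ (b :+ s) :+ b) refl
                                                      (length P) (length B) (length S) ⟩
  length P + (length B + length S) + length B    ≡⟨ cong (_+ length B) (sym (trans (length-++ P) (cong (length P +_) (length-++ B)))) ⟩
  length (before P B S) + length B               ∎
  where open ≡-Reasoning

-- Encoding admissible sequences as duplication histories

-- A gene sequence P ++ B ++ S with a pending duplication of the block B = b ∷ bs.
-- The prefix is stored reversed, so that growing the block to the left is a cons.
data State : Set where
  state : (revPrefix : List Gene) (b : Gene) (bs suffix : List Gene) → State

revPrefix prefix block suffix genes leaves : State → List Gene
revPrefix (state r _ _ _) = r
prefix s                  = reverse (revPrefix s)
block (state _ b bs _)    = b ∷ bs
suffix (state _ _ _ S)    = S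
genes s                   = before (prefix s) (block s) (suffix s)
leaves s                  = after (prefix s) (block s) (suffix s)

grow : State → State
grow (state []      b bs S) = state [] b bs S
grow (state (x ∷ r) b bs S) = state r x (b ∷ bs) S

restartAt : List Gene → ℕ → List Gene → State
restartAt F q []         = state [] [] [] []
restartAt F q (x ∷ rest) = state (reverse (take q F)) x [] rest

-- Perform the pending duplication and open a new one on the single gene at position q.
restart : List Gene → ℕ → State
restart F q = restartAt F q (drop q F)

step : State → ℕ → State
step s q with suc q ≟ length (revPrefix s)
... | yes _ = grow s
... | no  _ = restart (leaves s) q

-- Sequences are stored newest first; the initial state is the root with its duplication pending.
build : List ℕ → State
build []      = state [] [] [] []
build (q ∷ r) = step (build r) q

newest : List ℕ → ℕ
newest []      = 0
newest (q ∷ _) = q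

-- For q_t ∷ … ∷ q_1: q_t ≤ t and q_{t-1} ≤ q_t + 1, where q₀ = 0.
Admissible : List ℕ → Set
Admissible []      = ⊤
Admissible (q ∷ r) = Admissible r × q ≤ suc (length r) × newest r ≤ suc q

suc≡⇒0< : ∀ {q m} → suc q ≡ m → 0 < m
suc≡⇒0< refl = s≤s z≤n

step-cases : ∀ s q → (suc q ≡ length (revPrefix s) × step s q ≡ grow s)
                   ⊎ (suc q ≢ length (revPrefix s) × step s q ≡ restart (leaves s) q)
step-cases s q with suc q ≟ length (revPrefix s)
... | yes p = inj₁ (p , refl)
... | no ¬p = inj₂ (¬p , refl)

data RestartView (F : List Gene) (q : ℕ) : State → Set where
  restarted : ∀ x rest → take q F ++ x ∷ rest ≡ F → RestartView F q (state (reverse (take q F)) x [] rest)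

restart-view : ∀ F q → q < length F → RestartView F q (restart F q)
restart-view F q q<|F| = view (drop q F) (take++drop≡id q F) (subst (0 <_) (sym (length-drop q F)) (m<n⇒0<n∸m q<|F|))
  where
    view : ∀ ys → take q F ++ ys ≡ F → 0 < length ys → RestartView F q (restartAt F q ys)
    view (x ∷ rest) e _ = restarted x rest e

genes-restart : ∀ F q → q < length F → genes (restart F q) ≡ F
genes-restart F q q<|F| with restart F q | restart-view F q q<|F|
... | _ | restarted x rest e = trans (cong (_++ x ∷ rest) (reverse-involutive (take q F))) e

prefix-restart : ∀ F q → q < length F → length (prefix (restart F q)) ≡ q
prefix-restart F q q<|F| with restart F q | restart-view F q q<|F|
... | _ | restarted x rest _ = begin
  length (reverse (reverse (take q F))) ≡⟨ cong length (reverse-involutive (take q F)) ⟩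
  length (take q F)                     ≡⟨ length-take q F ⟩
  q ⊓ length F                          ≡⟨ m≤n⇒m⊓n≡m (<⇒≤ q<|F|) ⟩
  q                                     ∎
  where open ≡-Reasoning

block-restart : ∀ F q → ∃ λ x → block (restart F q) ≡ x ∷ []
block-restart F q with drop q F
... | []    = [] , refl
... | x ∷ _ = x , refl

genes-grow : ∀ s → 0 < length (revPrefix s) → genes (grow s) ≡ genes s
genes-grow (state (x ∷ r) b bs S) _ = begin
  reverse r ++ (x ∷ b ∷ bs) ++ S          ≡⟨ sym (++-assoc (reverse r) (x ∷ []) _) ⟩
  (reverse r ∷ʳ x) ++ (b ∷ bs) ++ S       ≡⟨ cong (_++ (b ∷ bs) ++ S) (sym (unfold-reverse x r)) ⟩
  reverse (x ∷ r) ++ (b ∷ bs) ++ S        ∎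
  where open ≡-Reasoning

length-revPrefix-grow : ∀ s → 0 < length (revPrefix s) → suc (length (revPrefix (grow s))) ≡ length (revPrefix s)
length-revPrefix-grow (state (x ∷ r) b bs S) _ = refl

length-block-grow : ∀ s → 0 < length (revPrefix s) → length (block (grow s)) ≡ suc (length (block s))
length-block-grow (state (x ∷ r) b bs S) _ = refl

length-prefix-grow : ∀ s → length (prefix (grow s)) + length (block (grow s)) ≡ length (prefix s) + length (block s)
length-prefix-grow (state []      b bs S) = refl
length-prefix-grow (state (x ∷ r) b bs S) = begin
  length (reverse r) + suc (length (b ∷ bs)) ≡⟨ +-suc _ _ ⟩
  suc (length (reverse r)) + length (b ∷ bs) ≡⟨ cong (λ m → suc m + length (b ∷ bs)) (length-reverse r) ⟩
  suc (length r) + length (b ∷ bs)           ≡⟨ cong (_+ length (b ∷ bs)) (sym (length-reverse (x ∷ r))) ⟩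
  length (reverse (x ∷ r)) + length (b ∷ bs) ∎
  where open ≡-Reasoning

record Invariant (s : State) (q n : ℕ) : Set where
  field
    prefix-length : length (prefix s) ≡ q
    leaves-length : length (leaves s) ≡ 2 + n
    prefixFree    : PrefixFree (genes s)
    -- makes the block's tandem the rightmost one in the leaves (tandems-after)
    early         : TandemsBefore (genes s) (length (prefix s) + length (block s))
    reachable     : Reachable (genes s)

open Invariant

length-leaves : ∀ s → length (leaves s) ≡ length (genes s) + length (block s)
length-leaves s = length-after (prefix s) (block s) (suffix s)

reachable-leaves : ∀ s → Reachable (genes s) → Reachable (leaves s)
reachable-leaves (state r b bs S) = dup (reverse r) b bs S

grow-invariant : ∀ {s q q′ n} → Invariant s q′ n → suc q ≡ length (revPrefix s) → Invariant (grow s) q (suc n)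
grow-invariant {s} {q} {n = n} σ q+1≡ = record
  { prefix-length = suc-injective (begin
      suc (length (prefix (grow s)))    ≡⟨ cong suc (length-reverse (revPrefix (grow s))) ⟩
      suc (length (revPrefix (grow s))) ≡⟨ length-revPrefix-grow s 0<|r| ⟩
      length (revPrefix s)              ≡⟨ sym q+1≡ ⟩
      suc q                             ∎)
  ; leaves-length = begin
      length (leaves (grow s))                          ≡⟨ length-leaves (grow s) ⟩
      length (genes (grow s)) + length (block (grow s)) ≡⟨ cong₂ _+_ (cong length same-genes) (length-block-grow s 0<|r|) ⟩
      length (genes s) + suc (length (block s))         ≡⟨ +-suc _ _ ⟩
      suc (length (genes s) + length (block s))         ≡⟨ cong suc (trans (sym (length-leaves s)) (leaves-length σ)) ⟩
      suc (2 + n)                                       ∎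
  ; prefixFree    = subst PrefixFree (sym same-genes) (prefixFree σ)
  ; early         = subst₂ TandemsBefore (sym same-genes) (sym (length-prefix-grow s)) (early σ)
  ; reachable     = subst Reachable (sym same-genes) (reachable σ)
  }
  where
    open ≡-Reasoning
    0<|r| : 0 < length (revPrefix s)
    0<|r| = suc≡⇒0< q+1≡
    same-genes : genes (grow s) ≡ genes s
    same-genes = genes-grow s 0<|r|

below-leaves : ∀ {s q q′ n} → Invariant s q′ n → q ≤ suc n → q < length (leaves s)
below-leaves {q = q} σ q≤n+1 = subst (q <_) (sym (leaves-length σ)) (s≤s q≤n+1)

restart-invariant : ∀ {s q q′ n} → Invariant s q′ n → q ≤ suc n → q′ ≤ q → Invariant (restart (leaves s) q) q (suc n)
restart-invariant {s} {q} {q′} {n} σ q≤n+1 q′≤q = record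
  { prefix-length = prefix-restart F q q<|F|
  ; leaves-length = begin-equality
      length (leaves s′)                      ≡⟨ length-leaves s′ ⟩
      length (genes s′) + length (block s′)   ≡⟨ cong₂ _+_ (cong length same-genes) (cong length (proj₂ (block-restart F q))) ⟩
      length F + 1                            ≡⟨ cong (_+ 1) (leaves-length σ) ⟩
      2 + n + 1                               ≡⟨ +-comm (2 + n) 1 ⟩
      2 + suc n                               ∎
  ; prefixFree    = subst PrefixFree (sym same-genes) leaves-prefixFree
  ; early         = λ {c} T → begin-strict
      c                                       ≤⟨ tandems-after (prefix s) (block s) (suffix s) leaves-prefixFree (early σ)
                                                   (subst (λ G → Tandem G c _) same-genes T) ⟩
      length (prefix s)                       ≡⟨ prefix-length σ ⟩
      q′                                      ≤⟨ q′≤q ⟩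
      q                                       <⟨ n<1+n q ⟩
      suc q                                   ≡⟨ +-comm 1 q ⟩
      q + 1                                   ≡⟨ sym (cong₂ _+_ (prefix-restart F q q<|F|) (cong length (proj₂ (block-restart F q)))) ⟩
      length (prefix s′) + length (block s′)  ∎
  ; reachable     = subst Reachable (sym same-genes) (reachable-leaves s (reachable σ))
  }
  where
    F : List Gene
    F = leaves s
    s′ : State
    s′ = restart F q
    leaves-prefixFree : PrefixFree F
    leaves-prefixFree = prefixFree-after (prefix s) (block s) (suffix s) (prefixFree σ)
    q<|F| : q < length F
    q<|F| = below-leaves σ q≤n+1
    same-genes : genes s′ ≡ F
    same-genes = genes-restart F q q<|F|
    open ≤-Reasoning

step-invariant : ∀ {s q q′ n} → Invariant s q′ n → q ≤ suc n → q′ ≤ suc q → Invariant (step s q) q (suc n)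
step-invariant {s} {q} {q′} σ q≤n+1 q′≤q+1 with step-cases s q
... | inj₁ (q+1≡ , e) = subst (λ t → Invariant t q _) (sym e) (grow-invariant σ q+1≡)
... | inj₂ (q+1≢ , e) = subst (λ t → Invariant t q _) (sym e) (restart-invariant σ q≤n+1 q′≤q)
  where
    q′≤q : q′ ≤ q
    q′≤q = s≤s⁻¹ (≤∧≢⇒< q′≤q+1 λ q′≡ →
             q+1≢ (trans (sym q′≡) (trans (sym (prefix-length σ)) (length-reverse (revPrefix s)))))

build-invariant : ∀ {r} → Admissible r → Invariant (build r) (newest r) (length r)
build-invariant {[]} _ = record
  { prefix-length = refl
  ; leaves-length = refl
  ; prefixFree    = root-prefixFree
  ; early         = λ T → ⊥-elim (root-no-tandem T)
  ; reachable     = root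
  }
  where
    root-prefixFree : PrefixFree ([] ∷ [])
    root-prefixFree {zero}  {zero}  _ _  _ = refl
    root-prefixFree {zero}  {suc j} _ () _
    root-prefixFree {suc i}         () _ _
    root-no-tandem : ∀ {c k} → ¬ Tandem ([] ∷ []) c k
    root-no-tandem {c} {k} T = <⇒≱ (nth-just⇒< ([] ∷ []) (proj₂ (proj₂ (tandem-head T)))) (≤-trans (Tandem.nonempty T) (m≤n+m k c))
build-invariant {q ∷ r} (α , q≤ , r≤) = step-invariant (build-invariant α) q≤ r≤

block-nonempty : ∀ s → 1 ≤ length (block s)
block-nonempty (state _ _ _ _) = s≤s z≤n

state-≡ : ∀ {s s′} → prefix s ≡ prefix s′ → block s ≡ block s′ → suffix s ≡ suffix s′ → s ≡ s′
state-≡ {state r b bs S} {state r′ b′ bs′ S′} eP eB eS with reverse-injective {x = r} {y = r′} eP | ∷-injective eB | eS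
... | refl | refl , refl | refl = refl

leaves-injective : ∀ {s s′ q q′ n n′} → Invariant s q n → Invariant s′ q′ n′ → leaves s ≡ leaves s′ → s ≡ s′
leaves-injective {s} {s′} σ σ′ e
  with after-injective (block-nonempty s) (block-nonempty s′)
         (prefixFree-after (prefix s) (block s) (suffix s) (prefixFree σ)) (early σ) (early σ′) e
... | eP , eB , eS = state-≡ eP eB eS

grow-injective : ∀ {s s′} → 0 < length (revPrefix s) → 0 < length (revPrefix s′) → grow s ≡ grow s′ → s ≡ s′
grow-injective {state (x ∷ r) b bs S} {state (x′ ∷ r′) b′ bs′ S′} _ _ refl = refl

restart-injective : ∀ {F F′ q} → q < length F → q < length F′ → restart F q ≡ restart F′ q → F ≡ F′
restart-injective {F} {F′} {q} p p′ e = trans (sym (genes-restart F q p)) (trans (cong genes e) (genes-restart F′ q p′))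

grow≢restart : ∀ s F q → 0 < length (revPrefix s) → grow s ≢ restart F q
grow≢restart s@(state _ _ _ _) F q 0<|r| e with block-restart F q
... | x , b≡ = 1+n≢0 (suc-injective (trans (sym (length-block-grow s 0<|r|)) (trans (cong (length ∘ block) e) (cong length b≡))))

step-injective : ∀ {s s′ q q₀ q₀′ n n′} → Invariant s q₀ n → Invariant s′ q₀′ n′ → q ≤ suc n → q ≤ suc n′ →
                 step s q ≡ step s′ q → s ≡ s′
step-injective {s} {s′} {q} σ σ′ q≤ q≤′ e with step-cases s q | step-cases s′ q
... | inj₁ (g , e₁) | inj₁ (g′ , e₁′) = grow-injective (suc≡⇒0< g) (suc≡⇒0< g′) (trans (sym e₁) (trans e e₁′))
... | inj₂ (_ , e₁) | inj₂ (_ , e₁′) =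
  leaves-injective σ σ′ (restart-injective (below-leaves σ q≤) (below-leaves σ′ q≤′) (trans (sym e₁) (trans e e₁′)))
... | inj₁ (g , e₁) | inj₂ (_ , e₁′) = ⊥-elim (grow≢restart s _ q (suc≡⇒0< g) (trans (sym e₁) (trans e e₁′)))
... | inj₂ (_ , e₁) | inj₁ (g′ , e₁′) = ⊥-elim (grow≢restart s′ _ q (suc≡⇒0< g′) (trans (sym e₁′) (trans (sym e) e₁)))

build-injective : ∀ {r r′} → Admissible r → Admissible r′ → length r ≡ length r′ → build r ≡ build r′ → r ≡ r′
build-injective {[]}    {[]}      _ _ _ _ = refl
build-injective {q ∷ r} {q′ ∷ r′} α@(α₀ , q≤ , _) α′@(α₀′ , q′≤ , _) |r|≡ e
  with trans (sym (prefix-length (build-invariant α))) (trans (cong (length ∘ prefix) e) (prefix-length (build-invariant α′)))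
... | refl = cong (q ∷_) (build-injective α₀ α₀′ (suc-injective |r|≡)
                            (step-injective (build-invariant α₀) (build-invariant α₀′) q≤ q′≤ e))

encode : List ℕ → List Gene
encode r = leaves (build r)

encode-isDuplicationTree : ∀ {r} → Admissible r → IsDuplicationTree (2 + length r) (encode r)
encode-isDuplicationTree {r} α = reachable-leaves (build r) (reachable (build-invariant α)) , leaves-length (build-invariant α)

encode-injective : ∀ {r r′} → Admissible r → Admissible r′ → encode r ≡ encode r′ → r ≡ r′
encode-injective {r} {r′} α α′ e = build-injective α α′ |r|≡|r′| (leaves-injective σ σ′ e)
  where
    σ : Invariant (build r) (newest r) (length r)
    σ = build-invariant α
    σ′ : Invariant (build r′) (newest r′) (length r′)
    σ′ = build-invariant α′
    |r|≡|r′| : length r ≡ length r′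
    |r|≡|r′| = suc-injective (suc-injective (trans (sym (leaves-length σ)) (trans (cong length e) (leaves-length σ′))))

-- Enumerating duplication trees

cuts : List A → List (List A × List A)
cuts []       = ([] , []) ∷ []
cuts (y ∷ ys) = ([] , y ∷ ys) ∷ map (map₁ (y ∷_)) (cuts ys)

∈-cuts⁺ : ∀ (xs ys : List A) → (xs , ys) ∈ cuts (xs ++ ys)
∈-cuts⁺ []       []       = here refl
∈-cuts⁺ []       (y ∷ ys) = here refl
∈-cuts⁺ (x ∷ xs) ys       = there (∈-map⁺ (map₁ (x ∷_)) (∈-cuts⁺ xs ys))

∈-cuts⁻ : ∀ (zs : List A) {xs ys} → (xs , ys) ∈ cuts zs → xs ++ ys ≡ zs
∈-cuts⁻ []       (here refl) = refl
∈-cuts⁻ (z ∷ zs) (here refl) = refl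
∈-cuts⁻ (z ∷ zs) (there m) with ∈-map⁻ (map₁ (z ∷_)) m
... | _ , m′ , refl = cong (z ∷_) (∈-cuts⁻ zs m′)

-- (pre , g , gs , suf) duplicates the block g ∷ gs of pre ++ (g ∷ gs) ++ suf.
Event : Set
Event = List Gene × Gene × List Gene × List Gene

events : List Gene → List Event
events []       = []
events (x ∷ xs) = map (λ (gs , suf) → [] , x , gs , suf) (cuts xs) ++ map (map₁ (x ∷_)) (events xs)

∈-events⁺ : ∀ pre g gs suf → (pre , g , gs , suf) ∈ events (before pre (g ∷ gs) suf)
∈-events⁺ []        g gs suf = ∈-++⁺ˡ (∈-map⁺ (λ (gs , suf) → [] , g , gs , suf) (∈-cuts⁺ gs suf))
∈-events⁺ (p ∷ pre) g gs suf = ∈-++⁺ʳ _ (∈-map⁺ (map₁ (p ∷_)) (∈-events⁺ pre g gs suf))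

∈-events⁻ : ∀ L {pre g gs suf} → (pre , g , gs , suf) ∈ events L → before pre (g ∷ gs) suf ≡ L
∈-events⁻ (x ∷ xs) m with ∈-++⁻ (map (λ (gs , suf) → [] , x , gs , suf) (cuts xs)) m
... | inj₁ m′ with ∈-map⁻ (λ (gs , suf) → [] , x , gs , suf) m′
...   | _ , m″ , refl = cong (x ∷_) (∈-cuts⁻ xs m″)
∈-events⁻ (x ∷ xs) m | inj₂ m′ with ∈-map⁻ (map₁ (x ∷_)) m′
...   | _ , m″ , refl = cong (x ∷_) (∈-events⁻ xs m″)

perform : Event → List Gene
perform (pre , g , gs , suf) = after pre (g ∷ gs) suf

reachableWithin : ℕ → List (List Gene)
reachableWithin zero    = ([] ∷ []) ∷ []
reachableWithin (suc k) = reachableWithin k ++ concatMap (map perform ∘ events) (reachableWithin k)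

reachableWithin-sound : ∀ k {L} → L ∈ reachableWithin k → Reachable L
reachableWithin-sound zero    (here refl) = root
reachableWithin-sound (suc k) m with ∈-++⁻ (reachableWithin k) m
... | inj₁ m′ = reachableWithin-sound k m′
... | inj₂ m′ with find (∈-concatMap⁻ (map perform ∘ events) {xs = reachableWithin k} m′)
...   | L , mL , mE with ∈-map⁻ perform mE
...     | (pre , g , gs , suf) , mev , refl =
  dup pre g gs suf (subst Reachable (sym (∈-events⁻ L mev)) (reachableWithin-sound k mL))

root∈reachableWithin : ∀ k → ([] ∷ []) ∈ reachableWithin k
root∈reachableWithin zero    = here refl
root∈reachableWithin (suc k) = ∈-++⁺ˡ (root∈reachableWithin k)

before<after : ∀ pre g gs suf → length (before pre (g ∷ gs) suf) < length (after pre (g ∷ gs) suf)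
before<after pre g gs suf =
  subst (length (before pre (g ∷ gs) suf) <_) (sym (length-after pre (g ∷ gs) suf)) (m<m+n _ (s≤s z≤n))

reachableWithin-complete : ∀ {L} → Reachable L → ∀ k → length L ≤ suc k → L ∈ reachableWithin k
reachableWithin-complete root                 k       _ = root∈reachableWithin k
reachableWithin-complete (dup pre g gs suf R) zero    bound =
  ⊥-elim (<⇒≱ (≤-<-trans (length-++-≤ʳ (g ∷ gs ++ suf) {pre}) (before<after pre g gs suf)) (≤-trans bound (s≤s z≤n)))
reachableWithin-complete (dup pre g gs suf R) (suc k) bound =
  ∈-++⁺ʳ (reachableWithin k) (∈-concatMap⁺ (map perform ∘ events) (lose earlier (∈-map⁺ perform (∈-events⁺ pre g gs suf))))
  where
    earlier : before pre (g ∷ gs) suf ∈ reachableWithin k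
    earlier = reachableWithin-complete R k (s≤s⁻¹ (≤-trans (before<after pre g gs suf) bound))

_≟Genes_ : DecidableEquality (List Gene)
_≟Genes_ = ≡-dec (≡-dec Bool._≟_)

duplicationTrees : ℕ → List (List Gene)
duplicationTrees n = deduplicate _≟Genes_ (filter (λ L → length L ≟ n) (reachableWithin (n ∸ 1)))

∈-duplicationTrees⁺ : ∀ {n L} → IsDuplicationTree n L → L ∈ duplicationTrees n
∈-duplicationTrees⁺ {n} (R , |L|≡n) =
  ∈-deduplicate⁺ _≟Genes_ (∈-filter⁺ (λ L → length L ≟ n)
    (reachableWithin-complete R (n ∸ 1) (subst (_≤ suc (n ∸ 1)) (sym |L|≡n) (m≤n+m∸n n 1))) |L|≡n)

∈-duplicationTrees⁻ : ∀ {n L} → L ∈ duplicationTrees n → IsDuplicationTree n L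
∈-duplicationTrees⁻ {n} L∈ with ∈-filter⁻ (λ L → length L ≟ n) (∈-deduplicate⁻ _≟Genes_ _ L∈)
... | L∈′ , |L|≡n = reachableWithin-sound (n ∸ 1) L∈′ , |L|≡n

duplicationTrees-size : ∀ n → HasSize (IsDuplicationTree n) (length (duplicationTrees n))
duplicationTrees-size n = duplicationTrees n , deduplicate-! _≟Genes_ _ , refl , λ L → ∈-duplicationTrees⁺ , ∈-duplicationTrees⁻

-- Manacher arrays

isLargest-unique : ∀ {P r r′} → IsLargest P r → IsLargest P r′ → r ≡ r′
isLargest-unique (p , max) (p′ , max′) = ≤-antisym (max′ _ p) (max _ p′)

module _ {P : ℕ → Set} (P? : Decidable P) where

  largestBelow : ℕ → ℕ
  largestBelow zero    = 0
  largestBelow (suc b) with P? b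
  ... | yes _ = b
  ... | no  _ = largestBelow b

  largestBelow-isLargest : ∀ b → P 0 → (∀ r → P r → r < b) → IsLargest P (largestBelow b)
  largestBelow-isLargest zero    p0 bound = ⊥-elim (n≮0 (bound 0 p0))
  largestBelow-isLargest (suc b) p0 bound with P? b
  ... | yes pb = pb , λ r pr → s≤s⁻¹ (bound r pr)
  ... | no ¬pb = largestBelow-isLargest b p0 λ r pr → ≤∧≢⇒< (s≤s⁻¹ (bound r pr)) (λ r≡b → ¬pb (subst P r≡b pr))

palindrome? : (w : List ℕ) → Dec (IsPalindrome w)
palindrome? w = ≡-dec _≟_ (reverse w) w

oddOK? : ∀ S k → Decidable (OddOK S k)
oddOK? S k r = (r <? k) ×-dec ((k + r ≤? length S) ×-dec palindrome? _)

evenOK? : ∀ S k → Decidable (EvenOK S k)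
evenOK? S k r = (r ≤? k) ×-dec ((k + r ≤? length S) ×-dec palindrome? _)

maxOdd maxEven : List ℕ → ℕ → ℕ
maxOdd  S k = largestBelow (oddOK? S k) k
maxEven S k = largestBelow (evenOK? S k) (suc k)

palindrome-singleton : (xs : List A) → IsPalindrome (take 1 xs)
palindrome-singleton []      = refl
palindrome-singleton (x ∷ _) = refl

maxOdd-isLargest : ∀ S k → 1 ≤ k → k ≤ length S → IsLargest (OddOK S k) (maxOdd S k)
maxOdd-isLargest S k k≥1 k≤n = largestBelow-isLargest (oddOK? S k) k
  (k≥1 , subst (_≤ length S) (sym (+-identityʳ k)) k≤n ,
   subst (λ m → IsPalindrome (take m (drop (k ∸ 1) S))) (sym (trans (cong (λ m → suc m ∸ k) (+-identityʳ k)) (m+n∸n≡m 1 k)))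
         (palindrome-singleton _))
  (λ r → proj₁)

maxEven-isLargest : ∀ S k → k < length S → IsLargest (EvenOK S k) (maxEven S k)
maxEven-isLargest S k k<n = largestBelow-isLargest (evenOK? S k) (suc k)
  (z≤n , subst (_≤ length S) (sym (+-identityʳ k)) (<⇒≤ k<n) ,
   subst (λ m → IsPalindrome (take m (drop k S))) (sym (trans (cong (_∸ k) (+-identityʳ k)) (n∸n≡0 k))) refl)
  (λ r → s≤s ∘ proj₁)

-- entries S k j is the j-th entry (from 0) of the array read from the odd centre k on:
-- odd centre k, even centre k, odd centre k + 1, …
entries : List ℕ → ℕ → ℕ → ℕ
entries S k zero          = maxOdd S k
entries S k (suc zero)    = maxEven S k
entries S k (suc (suc j)) = entries S (suc k) j

entries-odd : ∀ S m k → entries S k (m + m) ≡ maxOdd S (m + k)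
entries-odd S zero    k = refl
entries-odd S (suc m) k = begin
  entries S k (suc m + suc m)   ≡⟨ cong (λ j → entries S k (suc j)) (+-suc m m) ⟩
  entries S (suc k) (m + m)     ≡⟨ entries-odd S m (suc k) ⟩
  maxOdd S (m + suc k)          ≡⟨ cong (maxOdd S) (+-suc m k) ⟩
  maxOdd S (suc m + k)          ∎
  where open ≡-Reasoning

entries-even : ∀ S m k → entries S k (suc (m + m)) ≡ maxEven S (m + k)
entries-even S zero    k = refl
entries-even S (suc m) k = begin
  entries S k (suc (suc m + suc m)) ≡⟨ cong (λ j → entries S k (suc (suc j))) (+-suc m m) ⟩
  entries S (suc k) (suc (m + m))   ≡⟨ entries-even S m (suc k) ⟩
  maxEven S (m + suc k)             ≡⟨ cong (maxEven S) (+-suc m k) ⟩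
  maxEven S (suc m + k)             ∎
  where open ≡-Reasoning

manacher : List ℕ → List ℕ
manacher S = applyUpTo (entries S 1) (2 * length S ∸ 1)

at-applyUpTo : ∀ (f : ℕ → ℕ) {m} j → j < m → at (applyUpTo f m) (suc j) ≡ just (f j)
at-applyUpTo f zero    (s≤s _)  = refl
at-applyUpTo f (suc j) (s≤s p)  = at-applyUpTo (f ∘ suc) j p

2[1+m]≡2+m+m : ∀ m → 2 * suc m ≡ suc (suc (m + m))
2[1+m]≡2+m+m m = cong suc (trans (cong (m +_) (+-identityʳ (suc m))) (+-suc m m))

2[1+m]∸1≡1+m+m : ∀ m → 2 * suc m ∸ 1 ≡ suc (m + m)
2[1+m]∸1≡1+m+m m = cong (_∸ 1) (2[1+m]≡2+m+m m)

m+m≤n+n⇒m≤n : ∀ {m n} → m + m ≤ n + n → m ≤ n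
m+m≤n+n⇒m≤n {m} {n} p with m ≤? n
... | yes m≤n = m≤n
... | no  m≰n = ⊥-elim (<⇒≱ (+-mono-< (≰⇒> m≰n) (≰⇒> m≰n)) p)

m+m<n+n⇒m<n : ∀ {m n} → m + m < n + n → m < n
m+m<n+n⇒m<n {m} {n} p with m <? n
... | yes m<n = m<n
... | no  m≮n = ⊥-elim (<⇒≱ p (+-mono-≤ (≮⇒≥ m≮n) (≮⇒≥ m≮n)))

m<n⇒m+m<2n∸1 : ∀ {m n} → m < n → m + m < 2 * n ∸ 1
m<n⇒m+m<2n∸1 {m} {suc n} (s≤s m≤n) = subst (m + m <_) (sym (2[1+m]∸1≡1+m+m n)) (s≤s (+-mono-≤ m≤n m≤n))

m+m<2n∸1⇒m<n : ∀ {m n} → m + m < 2 * n ∸ 1 → m < n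
m+m<2n∸1⇒m<n {m} {suc n} p = s≤s (m+m≤n+n⇒m≤n (s≤s⁻¹ (subst (m + m <_) (2[1+m]∸1≡1+m+m n) p)))

1+m<n⇒1+m+m<2n∸1 : ∀ {m n} → suc m < n → suc (m + m) < 2 * n ∸ 1
1+m<n⇒1+m+m<2n∸1 {m} {suc n} (s≤s m<n) =
  subst (suc (m + m) <_) (sym (2[1+m]∸1≡1+m+m n))
    (s≤s (≤-trans (n≤1+n _) (subst (_≤ n + n) (cong suc (+-suc m m)) (+-mono-≤ m<n m<n))))

1+m+m<2n∸1⇒1+m<n : ∀ {m n} → suc (m + m) < 2 * n ∸ 1 → suc m < n
1+m+m<2n∸1⇒1+m<n {m} {suc n} p = s≤s (m+m<n+n⇒m<n (s≤s⁻¹ (subst (suc (m + m) <_) (2[1+m]∸1≡1+m+m n) p)))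

manacher-isManacherArrayOf : ∀ S → IsManacherArrayOf S (manacher S)
manacher-isManacherArrayOf S = length-applyUpTo (entries S 1) (2 * length S ∸ 1) , odd , even
  where
    odd : ∀ k → 1 ≤ k → k ≤ length S → Σ ℕ λ r → at (manacher S) (2 * k ∸ 1) ≡ just r × IsLargest (OddOK S k) r
    odd (suc m) _ k≤n = maxOdd S (suc m) , (begin
        at (manacher S) (2 * suc m ∸ 1)  ≡⟨ cong (at (manacher S)) (2[1+m]∸1≡1+m+m m) ⟩
        at (manacher S) (suc (m + m))    ≡⟨ at-applyUpTo (entries S 1) (m + m) (m<n⇒m+m<2n∸1 k≤n) ⟩
        just (entries S 1 (m + m))       ≡⟨ cong just (entries-odd S m 1) ⟩
        just (maxOdd S (m + 1))          ≡⟨ cong (just ∘ maxOdd S) (+-comm m 1) ⟩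
        just (maxOdd S (suc m))          ∎)
      , maxOdd-isLargest S (suc m) (s≤s z≤n) k≤n
      where open ≡-Reasoning
    even : ∀ k → 1 ≤ k → k < length S → Σ ℕ λ r → at (manacher S) (2 * k) ≡ just r × IsLargest (EvenOK S k) r
    even (suc m) _ k<n = maxEven S (suc m) , (begin
        at (manacher S) (2 * suc m)        ≡⟨ cong (at (manacher S)) (2[1+m]≡2+m+m m) ⟩
        at (manacher S) (suc (suc (m + m))) ≡⟨ at-applyUpTo (entries S 1) (suc (m + m)) (1+m<n⇒1+m+m<2n∸1 k<n) ⟩
        just (entries S 1 (suc (m + m)))   ≡⟨ cong just (entries-even S m 1) ⟩
        just (maxEven S (m + 1))           ≡⟨ cong (just ∘ maxEven S) (+-comm m 1) ⟩
        just (maxEven S (suc m))           ∎)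
      , maxEven-isLargest S (suc m) k<n
      where open ≡-Reasoning

at-extensional : ∀ (M M′ : List ℕ) → length M ≡ length M′ →
                 (∀ j → j < length M → at M (suc j) ≡ at M′ (suc j)) → M ≡ M′
at-extensional []      []        _ _ = refl
at-extensional (x ∷ M) (x′ ∷ M′) l h with h 0 (s≤s z≤n)
... | refl = cong (x ∷_) (at-extensional M M′ (suc-injective l) (λ j p → h (suc j) (s≤s p)))

data Parity : ℕ → Set where
  even : ∀ m → Parity (m + m)
  odd  : ∀ m → Parity (suc (m + m))

parity : ∀ j → Parity j
parity zero    = even 0
parity (suc j) with parity j
... | even m = odd m
... | odd  m = subst Parity (cong suc (+-suc m m)) (even (suc m))

module _ {S : List A} {M M′ : List ℕ} (μ : IsManacherArrayOf S M) (μ′ : IsManacherArrayOf S M′) where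

  odd-entries-agree : ∀ m → suc m ≤ length S → at M (suc (m + m)) ≡ at M′ (suc (m + m))
  odd-entries-agree m k≤n with proj₁ (proj₂ μ) (suc m) (s≤s z≤n) k≤n | proj₁ (proj₂ μ′) (suc m) (s≤s z≤n) k≤n
  ... | r , at≡ , lg | r′ , at≡′ , lg′ = begin
    at M (suc (m + m))    ≡⟨ cong (at M) (sym (2[1+m]∸1≡1+m+m m)) ⟩
    at M (2 * suc m ∸ 1)  ≡⟨ at≡ ⟩
    just r                ≡⟨ cong just (isLargest-unique lg lg′) ⟩
    just r′               ≡⟨ sym at≡′ ⟩
    at M′ (2 * suc m ∸ 1) ≡⟨ cong (at M′) (2[1+m]∸1≡1+m+m m) ⟩
    at M′ (suc (m + m))   ∎
    where open ≡-Reasoning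

  even-entries-agree : ∀ m → suc m < length S → at M (suc (suc (m + m))) ≡ at M′ (suc (suc (m + m)))
  even-entries-agree m k<n with proj₂ (proj₂ μ) (suc m) (s≤s z≤n) k<n | proj₂ (proj₂ μ′) (suc m) (s≤s z≤n) k<n
  ... | r , at≡ , lg | r′ , at≡′ , lg′ = begin
    at M (suc (suc (m + m)))  ≡⟨ cong (at M) (sym (2[1+m]≡2+m+m m)) ⟩
    at M (2 * suc m)          ≡⟨ at≡ ⟩
    just r                    ≡⟨ cong just (isLargest-unique lg lg′) ⟩
    just r′                   ≡⟨ sym at≡′ ⟩
    at M′ (2 * suc m)         ≡⟨ cong (at M′) (2[1+m]≡2+m+m m) ⟩
    at M′ (suc (suc (m + m))) ∎
    where open ≡-Reasoning

  manacherArray-unique : M ≡ M′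
  manacherArray-unique = at-extensional M M′ (trans |M| (sym (proj₁ μ′))) agree
    where
      |M| : length M ≡ 2 * length S ∸ 1
      |M| = proj₁ μ
      agree : ∀ j → j < length M → at M (suc j) ≡ at M′ (suc j)
      agree j j<|M| with parity j
      ... | even m = odd-entries-agree m (m+m<2n∸1⇒m<n (subst (m + m <_) |M| j<|M|))
      ... | odd  m = even-entries-agree m (1+m+m<2n∸1⇒1+m<n (subst (suc (m + m) <_) |M| j<|M|))

PalindromeAt : List A → ℕ → ℕ → Set
PalindromeAt S i len = IsPalindrome (take len (drop i S))

SamePalindromes : List A → List C → Set
SamePalindromes S S′ = ∀ i len → PalindromeAt S i len ⇔ PalindromeAt S′ i len

isLargest-resp : ∀ {P Q : ℕ → Set} {r} → (∀ r → P r ⇔ Q r) → IsLargest P r → IsLargest Q r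
isLargest-resp P⇔Q (p , max) = to (P⇔Q _) p , λ r′ q → max r′ (from (P⇔Q r′) q)

module _ {S : List A} {S′ : List C} (|S|≡ : length S ≡ length S′) (same : SamePalindromes S S′) where

  oddOK⇔ : ∀ k r → OddOK S k r ⇔ OddOK S′ k r
  oddOK⇔ k r = mk⇔ (λ (r<k , bound , pal) → r<k , subst (k + r ≤_) |S|≡ bound , to (same (k ∸ r ∸ 1) _) pal)
                   (λ (r<k , bound , pal) → r<k , subst (k + r ≤_) (sym |S|≡) bound , from (same (k ∸ r ∸ 1) _) pal)

  evenOK⇔ : ∀ k r → EvenOK S k r ⇔ EvenOK S′ k r
  evenOK⇔ k r = mk⇔ (λ (r≤k , bound , pal) → r≤k , subst (k + r ≤_) |S|≡ bound , to (same (suc k ∸ r ∸ 1) _) pal)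
                    (λ (r≤k , bound , pal) → r≤k , subst (k + r ≤_) (sym |S|≡) bound , from (same (suc k ∸ r ∸ 1) _) pal)

  manacherArray-transfer : ∀ {M} → IsManacherArrayOf S M → IsManacherArrayOf S′ M
  manacherArray-transfer {M} (l , o , e) = trans l (cong (λ n → 2 * n ∸ 1) |S|≡) , o′ , e′
    where
      o′ : ∀ k → 1 ≤ k → k ≤ length S′ → Σ ℕ λ r → at M (2 * k ∸ 1) ≡ just r × IsLargest (OddOK S′ k) r
      o′ k k≥1 k≤n with o k k≥1 (subst (k ≤_) (sym |S|≡) k≤n)
      ... | r , at≡ , lg = r , at≡ , isLargest-resp (oddOK⇔ k) lg
      e′ : ∀ k → 1 ≤ k → k < length S′ → Σ ℕ λ r → at M (2 * k) ≡ just r × IsLargest (EvenOK S′ k) r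
      e′ k k≥1 k<n with e k k≥1 (subst (k <_) (sym |S|≡) k<n)
      ... | r , at≡ , lg = r , at≡ , isLargest-resp (evenOK⇔ k) lg

words : ℕ → ℕ → List (List ℕ)
words zero    c = [] ∷ []
words (suc m) c = cartesianProductWith _∷_ (upTo c) (words m c)

∈-words⁺ : ∀ {c} (w : List ℕ) → All (_< c) w → w ∈ words (length w) c
∈-words⁺ []      []         = here refl
∈-words⁺ (x ∷ w) (x<c ∷ w<c) = ∈-cartesianProductWith⁺ _∷_ (∈-upTo⁺ x<c) (∈-words⁺ w w<c)

∈-words⁻ : ∀ m {c w} → w ∈ words m c → length w ≡ m
∈-words⁻ zero    (here refl) = refl
∈-words⁻ (suc m) {c} w∈ with ∈-cartesianProductWith⁻ _∷_ (upTo c) (words m c) w∈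
... | _ , _ , _ , w∈′ , refl = cong suc (∈-words⁻ m w∈′)

module _ {X : Set} (f : X → A) (g : X → C) (f⇒g : ∀ {x y} → f x ≡ f y → g x ≡ g y) where

  map-≡-map : ∀ {u v} → map f u ≡ map f v → map g u ≡ map g v
  map-≡-map {[]}    {[]}    _ = refl
  map-≡-map {x ∷ u} {y ∷ v} e = cong₂ _∷_ (f⇒g (∷-injectiveˡ e)) (map-≡-map (∷-injectiveʳ e))

  palindrome-map : ∀ w → IsPalindrome (map f w) → IsPalindrome (map g w)
  palindrome-map w p = begin
    reverse (map g w) ≡⟨ sym (reverse-map g w) ⟩
    map g (reverse w) ≡⟨ map-≡-map (trans (reverse-map f w) p) ⟩
    map g w           ∎
    where open ≡-Reasoning

window-map : ∀ (f : A → C) L i len → take len (drop i (map f L)) ≡ map f (take len (drop i L))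
window-map f L i len = trans (cong (take len) (drop-map i L)) (take-map len (drop i L))

map-samePalindromes : ∀ {X : Set} (f : X → A) (g : X → C) → (∀ x y → f x ≡ f y ⇔ g x ≡ g y) →
                      ∀ L → SamePalindromes (map f L) (map g L)
map-samePalindromes f g f⇔g L i len = mk⇔ (transport f g (to (f⇔g _ _))) (transport g f (from (f⇔g _ _)))
  where
    transport : ∀ {D E : Set} (f : _ → D) (g : _ → E) → (∀ {x y} → f x ≡ f y → g x ≡ g y) →
                PalindromeAt (map f L) i len → PalindromeAt (map g L) i len
    transport f g f⇒g p = subst IsPalindrome (sym (window-map g L i len))
                            (palindrome-map f g f⇒g _ (subst IsPalindrome (window-map f L i len) p))

firstIndex : ∀ {n} {P : Fin n → Set} → Decidable P → ℕ
firstIndex {zero}  _  = 0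
firstIndex {suc n} P? with P? fzero
... | yes _ = 0
... | no  _ = suc (firstIndex (P? ∘ fsuc))

firstIndex-resp : ∀ {n} {P Q : Fin n → Set} (P? : Decidable P) (Q? : Decidable Q) →
                  (∀ i → P i ⇔ Q i) → firstIndex P? ≡ firstIndex Q?
firstIndex-resp {zero}  _  _  _   = refl
firstIndex-resp {suc n} P? Q? P⇔Q with P? fzero | Q? fzero
... | yes _  | yes _  = refl
... | yes p  | no ¬q  = ⊥-elim (¬q (to (P⇔Q fzero) p))
... | no ¬p  | yes q  = ⊥-elim (¬p (from (P⇔Q fzero) q))
... | no _   | no _   = cong suc (firstIndex-resp (P? ∘ fsuc) (Q? ∘ fsuc) (P⇔Q ∘ fsuc))

firstIndex-holds : ∀ {n} {P : Fin n → Set} (P? : Decidable P) {i} → P i → ∃ λ k → toℕ k ≡ firstIndex P? × P k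
firstIndex-holds {suc n} P? {i} p with P? fzero
... | yes p₀ = fzero , refl , p₀
firstIndex-holds {suc n} P? {fzero}  p | no ¬p₀ = ⊥-elim (¬p₀ p)
firstIndex-holds {suc n} P? {fsuc i} p | no _ with firstIndex-holds (P? ∘ fsuc) p
... | k , k≡ , pk = fsuc k , cong suc k≡ , pk

¬¬-sequence : ∀ {n} {P : Fin n → Set} → (∀ i → ¬ ¬ P i) → ¬ ¬ (∀ i → P i)
¬¬-sequence = Fin.sequence (RawMonad.rawApplicative ¬¬-Monad)

module _ {A : Set} (S : List A) where

  -- The alphabet need not have decidable equality, but the finitely many comparisons
  -- between letters of S are decidable under a double negation.
  letters-decidable-¬¬ : ¬ ¬ (∀ i j → Dec (lookup S i ≡ lookup S j))
  letters-decidable-¬¬ = ¬¬-sequence λ i → ¬¬-sequence λ j → ¬¬-excluded-middle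

  canonicalWord : (∀ i j → Dec (lookup S i ≡ lookup S j)) →
                  ∃ λ w → w ∈ words (length S) (length S) × SamePalindromes S w
  canonicalWord _≟ₛ_ = w , w∈words , subst (λ S′ → SamePalindromes S′ w) S≡ (map-samePalindromes (lookup S) first ≡⇔ L)
    where
      L : List (Fin (length S))
      L = allFin (length S)

      first : Fin (length S) → ℕ
      first i = firstIndex (_≟ₛ i)

      witness : ∀ i → ∃ λ k → toℕ k ≡ first i × lookup S k ≡ lookup S i
      witness i = firstIndex-holds (_≟ₛ i) refl

      same-first : ∀ {x y} → first x ≡ first y → lookup S x ≡ lookup S y
      same-first {x} {y} e with witness x | witness y
      ... | kx , kx≡ , Skx | ky , ky≡ , Sky =
        trans (sym Skx) (trans (cong (lookup S) (toℕ-injective (trans kx≡ (trans e (sym ky≡))))) Sky)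

      ≡⇔ : ∀ x y → lookup S x ≡ lookup S y ⇔ first x ≡ first y
      ≡⇔ x y = mk⇔ (λ e → firstIndex-resp (_≟ₛ x) (_≟ₛ y) λ j → mk⇔ (λ e′ → trans e′ e) (λ e′ → trans e′ (sym e)))
                   same-first

      S≡ : map (lookup S) L ≡ S
      S≡ = trans (map-tabulate (λ i → i) (lookup S)) (tabulate-lookup S)

      w : List ℕ
      w = map first L

      |w| : length w ≡ length S
      |w| = trans (length-map first L) (length-tabulate (λ i → i))

      w∈words : w ∈ words (length S) (length S)
      w∈words = subst (λ m → w ∈ words m (length S)) |w|
                  (∈-words⁺ w (All.map⁺ (All.tabulate⁺ λ i → subst (_< length S) (proj₁ (proj₂ (witness i))) (toℕ<n _))))

  canonicalWord-¬¬ : ¬ ¬ (∃ λ w → w ∈ words (length S) (length S) × SamePalindromes S w)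
  canonicalWord-¬¬ = ¬¬-map canonicalWord letters-decidable-¬¬

_≟ℕs_ : DecidableEquality (List ℕ)
_≟ℕs_ = ≡-dec _≟_

manacherArrays : ℕ → List (List ℕ)
manacherArrays n = deduplicate _≟ℕs_ (map manacher (words n n))

∈-manacherArrays⁻ : ∀ {n M} → M ∈ manacherArrays n → ∃ λ w → w ∈ words n n × M ≡ manacher w
∈-manacherArrays⁻ M∈ = ∈-map⁻ manacher (∈-deduplicate⁻ _≟ℕs_ _ M∈)

-- Membership in a list is decidable, hence stable under the double negation of canonicalWord-¬¬.
∈-manacherArrays⁺ : ∀ {n M} → IsManacherArray n M → M ∈ manacherArrays n
∈-manacherArrays⁺ {n} {M} (_ , S , refl , μ) = decidable-stable (M ∈? manacherArrays n) λ M∉ →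
  canonicalWord-¬¬ S λ (w , w∈ , same) →
    M∉ (∈-deduplicate⁺ _≟ℕs_ (subst (_∈ map manacher (words n n))
          (manacherArray-unique (manacher-isManacherArrayOf w) (manacherArray-transfer (sym (∈-words⁻ n w∈)) same {M} μ))
          (∈-map⁺ manacher w∈)))

manacherArrays-size : ∀ n → HasSize (IsManacherArray n) (length (manacherArrays n))
manacherArrays-size n = manacherArrays n , deduplicate-! _≟ℕs_ _ , refl , λ M → ∈-manacherArrays⁺ , sound
  where
    sound : ∀ {M} → M ∈ manacherArrays n → IsManacherArray n M
    sound M∈ with ∈-manacherArrays⁻ {n} M∈
    ... | w , w∈ , refl = ℕ , w , ∈-words⁻ n w∈ , manacher-isManacherArrayOf w

-- Longest palindromic suffixes

leastUpTo : ∀ {P : ℕ → Set} → Decidable P → ℕ → ℕ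
leastUpTo P? zero    = 0
leastUpTo P? (suc t) with P? 0
... | yes _ = 0
... | no  _ = suc (leastUpTo (λ i → P? (suc i)) t)

leastUpTo-≤ : ∀ {P : ℕ → Set} (P? : Decidable P) t → leastUpTo P? t ≤ t
leastUpTo-≤ P? zero    = z≤n
leastUpTo-≤ P? (suc t) with P? 0
... | yes _ = z≤n
... | no  _ = s≤s (leastUpTo-≤ (λ i → P? (suc i)) t)

leastUpTo-holds : ∀ {P : ℕ → Set} (P? : Decidable P) t → P t → P (leastUpTo P? t)
leastUpTo-holds P? zero    pt = pt
leastUpTo-holds P? (suc t) pt with P? 0
... | yes p₀ = p₀
... | no  _  = leastUpTo-holds (λ i → P? (suc i)) t pt

leastUpTo-minimal : ∀ {P : ℕ → Set} (P? : Decidable P) t {i} → P i → i ≤ t → leastUpTo P? t ≤ i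
leastUpTo-minimal P? zero    _ _ = z≤n
leastUpTo-minimal P? (suc t) {i} pi i≤t with P? 0
... | yes _ = z≤n
leastUpTo-minimal P? (suc t) {zero}  pi _         | no ¬p₀ = ⊥-elim (¬p₀ pi)
leastUpTo-minimal P? (suc t) {suc i} pi (s≤s i≤t) | no _   = s≤s (leastUpTo-minimal (λ j → P? (suc j)) t pi i≤t)

palSuffix? : ∀ S t → Decidable (λ i → PalindromeAt S i (suc t ∸ i))
palSuffix? S t i = palindrome? (take (suc t ∸ i) (drop i S))

-- Start of the longest palindromic suffix of S[0..t], positions counted from 0.
palSuffixStart : List ℕ → ℕ → ℕ
palSuffixStart S t = leastUpTo (palSuffix? S t) t

module _ (S : List ℕ) (t : ℕ) where

  palSuffixStart-≤ : palSuffixStart S t ≤ t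
  palSuffixStart-≤ = leastUpTo-≤ (palSuffix? S t) t

  palSuffixStart-palindrome : PalindromeAt S (palSuffixStart S t) (suc t ∸ palSuffixStart S t)
  palSuffixStart-palindrome = leastUpTo-holds (palSuffix? S t) t
    (subst (λ m → PalindromeAt S t m) (sym (m+n∸n≡m 1 t)) (palindrome-singleton (drop t S)))

  palSuffixStart-minimal : ∀ {i} → PalindromeAt S i (suc t ∸ i) → i ≤ t → palSuffixStart S t ≤ i
  palSuffixStart-minimal = leastUpTo-minimal (palSuffix? S t) t

window-length : ∀ {i len e} → i + len ≡ suc e → suc e ∸ i ≡ len
window-length {i} {len} e = trans (cong (_∸ i) (sym e)) (m+n∸m≡n i len)

palindromeAt-palSuffixStart : ∀ S {i len e} → i + len ≡ suc e → i ≡ palSuffixStart S e → PalindromeAt S i len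
palindromeAt-palSuffixStart S {e = e} end refl =
  subst (PalindromeAt S (palSuffixStart S e)) (window-length end) (palSuffixStart-palindrome S e)

not-palindrome-before-palSuffixStart : ∀ S {i len e} → i + len ≡ suc e → i < palSuffixStart S e → ¬ PalindromeAt S i len
not-palindrome-before-palSuffixStart S {i} {zero}    {e} end i<q _ =
  <⇒≱ i<q (≤-trans (palSuffixStart-≤ S e) (≤-trans (n≤1+n e) (≤-reflexive (trans (sym end) (+-identityʳ i)))))
not-palindrome-before-palSuffixStart S {i} {suc len} {e} end i<q p =
  <⇒≱ i<q (palSuffixStart-minimal S e (subst (PalindromeAt S i) (sym (window-length end)) p)
            (≤-pred (subst (i <_) end (m<m+n i (s≤s z≤n)))))

take-+ : ∀ m k (xs : List A) → take (m + k) xs ≡ take m xs ++ take k (drop m xs)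
take-+ zero    k xs       = refl
take-+ (suc m) k []       = sym (take-[] k)
take-+ (suc m) k (x ∷ xs) = cong (x ∷_) (take-+ m k xs)

take-++-length : ∀ (xs : List A) {ys k} → length xs ≡ k → take k (xs ++ ys) ≡ xs
take-++-length []       refl = refl
take-++-length (x ∷ xs) refl = cong (x ∷_) (take-++-length xs refl)

palindrome-reverse : ∀ (xs : List A) → IsPalindrome xs ⇔ IsPalindrome (reverse xs)
palindrome-reverse xs = mk⇔ (λ p → trans (reverse-involutive xs) (sym p)) (λ p → trans (sym p) (reverse-involutive xs))

palindrome-mirror : ∀ {X : Set} (S : List X) q m len → q + m + len ≤ length S → PalindromeAt S q (m + len) →
                    PalindromeAt S (q + m) len ⇔ PalindromeAt S q len
palindrome-mirror {X} S q m len bound outer =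
  subst₂ (λ u v → IsPalindrome u ⇔ IsPalindrome v) (sym inner≡β) (sym left≡rβ) (palindrome-reverse β)
  where
    xs α β : List X
    xs = drop q S
    α  = take m xs
    β  = take len (drop m xs)
    inner≡β : take len (drop (q + m) S) ≡ β
    inner≡β = cong (take len) (sym (drop-drop q m S))
    |β| : length β ≡ len
    |β| = trans (cong length (sym inner≡β)) (trans (length-take len _) (m≤n⇒m⊓n≡m (begin
      len                          ≤⟨ m+n≤o⇒m≤o∸n len (subst (_≤ length S) (+-comm (q + m) len) bound) ⟩
      length S ∸ (q + m)           ≡⟨ sym (length-drop (q + m) S) ⟩
      length (drop (q + m) S)      ∎)))
      where open ≤-Reasoning
    window≡ : take (m + len) xs ≡ reverse β ++ reverse α
    window≡ = trans (sym outer) (trans (cong reverse (take-+ m len xs)) (reverse-++ α β))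
    left≡rβ : take len xs ≡ reverse β
    left≡rβ = begin
      take len xs                       ≡⟨ sym (trans (take-take len (m + len) xs) (cong (λ k → take k xs) (m≤n⇒m⊓n≡m (m≤n+m len m)))) ⟩
      take len (take (m + len) xs)      ≡⟨ cong (take len) window≡ ⟩
      take len (reverse β ++ reverse α) ≡⟨ take-++-length (reverse β) (trans (length-reverse β) |β|) ⟩
      reverse β                         ∎
      where open ≡-Reasoning

module _ {S S′ : List ℕ} (|S|≡ : length S ≡ length S′)
         (q≡ : ∀ t → t < length S → palSuffixStart S t ≡ palSuffixStart S′ t) where

  -- Induction on the end of the window: a palindrome ending at e that starts after the
  -- longest palindromic suffix q of S[0..e] mirrors to one starting at q, which ends earlier.
  palindromes-agree-upTo : ∀ e → e ≤ length S → ∀ i len → i + len ≤ e → PalindromeAt S i len ⇔ PalindromeAt S′ i len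
  palindromes-agree-upTo e       _   i zero      _ = mk⇔ (λ _ → refl) (λ _ → refl)
  palindromes-agree-upTo zero    _   i (suc len) p = ⊥-elim (<⇒≱ (s≤s z≤n) (subst (_≤ 0) (+-suc i len) p))
  palindromes-agree-upTo (suc e) e<n i (suc len) p with m≤n⇒m<n∨m≡n p
  ... | inj₁ shorter = palindromes-agree-upTo e (<⇒≤ e<n) i (suc len) (s≤s⁻¹ shorter)
  ... | inj₂ end with <-cmp i (palSuffixStart S e)
  ...   | tri< i<q _ _ = mk⇔ (⊥-elim ∘ not-palindrome-before-palSuffixStart S end i<q)
                             (⊥-elim ∘ not-palindrome-before-palSuffixStart S′ end (subst (i <_) (q≡ e e<n) i<q))
  ...   | tri≈ _ i≡q _ = mk⇔ (λ _ → palindromeAt-palSuffixStart S′ end (trans i≡q (q≡ e e<n)))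
                             (λ _ → palindromeAt-palSuffixStart S end i≡q)
  ...   | tri> _ _ q<i = mirrored
    where
      q m i′ : ℕ
      q = palSuffixStart S e
      m = proj₁ (m≤n⇒∃[o]m+o≡n (<⇒≤ q<i))
      i′ = q + m
      q+m≡i : q + m ≡ i
      q+m≡i = proj₂ (m≤n⇒∃[o]m+o≡n (<⇒≤ q<i))
      outer-end : q + (m + suc len) ≡ suc e
      outer-end = trans (sym (+-assoc q m (suc len))) (trans (cong (_+ suc len) q+m≡i) end)
      bound : q + m + suc len ≤ length S
      bound = subst (_≤ length S) (sym (trans (cong (_+ suc len) q+m≡i) end)) e<n
      mirror : PalindromeAt S i′ (suc len) ⇔ PalindromeAt S q (suc len)
      mirror  = palindrome-mirror S q m (suc len) bound (palindromeAt-palSuffixStart S outer-end refl)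
      mirror′ : PalindromeAt S′ i′ (suc len) ⇔ PalindromeAt S′ q (suc len)
      mirror′ = palindrome-mirror S′ q m (suc len) (subst (q + m + suc len ≤_) |S|≡ bound)
                  (palindromeAt-palSuffixStart S′ outer-end (q≡ e e<n))
      earlier : PalindromeAt S q (suc len) ⇔ PalindromeAt S′ q (suc len)
      earlier = palindromes-agree-upTo e (<⇒≤ e<n) q (suc len) (s≤s⁻¹ (subst (q + suc len <_) end (+-monoˡ-< (suc len) q<i)))
      mirrored : PalindromeAt S i (suc len) ⇔ PalindromeAt S′ i (suc len)
      mirrored = subst (λ j → PalindromeAt S j (suc len) ⇔ PalindromeAt S′ j (suc len)) q+m≡i
                   (⇔.trans mirror (⇔.trans earlier (⇔.sym mirror′)))

take-⊓-length : ∀ len (xs : List A) → take len xs ≡ take (len ⊓ length xs) xs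
take-⊓-length len xs = trans (cong (take len) (sym (take-all (length xs) xs ≤-refl))) (take-take len (length xs) xs)

palindromeAt-beyond : ∀ (S : List A) {i} len → length S ≤ i → PalindromeAt S i len
palindromeAt-beyond S {i} len n≤i = subst IsPalindrome (sym (trans (cong (take len) (drop-all i S n≤i)) (take-[] len))) refl

samePalindromes-inRange : ∀ {S : List A} {S′ : List C} → length S ≡ length S′ →
                          (∀ i len → i + len ≤ length S → PalindromeAt S i len ⇔ PalindromeAt S′ i len) →
                          SamePalindromes S S′
samePalindromes-inRange {S = S} {S′} |S|≡ agree i len with i ≤? length S
... | no  i≰n = mk⇔ (λ _ → palindromeAt-beyond S′ len (subst (_≤ i) |S|≡ (<⇒≤ (≰⇒> i≰n))))
                    (λ _ → palindromeAt-beyond S len (<⇒≤ (≰⇒> i≰n)))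
... | yes i≤n = subst₂ (λ u v → IsPalindrome u ⇔ IsPalindrome v) (sym (clamp refl)) (sym (clamp |S|≡))
                  (agree i len′ bound)
  where
    len′ : ℕ
    len′ = len ⊓ (length S ∸ i)
    clamp : ∀ {D : Set} {T : List D} → length S ≡ length T → take len (drop i T) ≡ take len′ (drop i T)
    clamp {T = T} e = trans (take-⊓-length len (drop i T))
                            (cong (λ k → take (len ⊓ k) (drop i T)) (trans (length-drop i T) (cong (_∸ i) (sym e))))
    bound : i + len′ ≤ length S
    bound = ≤-trans (+-monoʳ-≤ i (m⊓n≤n len _)) (≤-reflexive (m+[n∸m]≡n i≤n))

take-suc-∷ʳ : ∀ k (xs : List A) → k < length xs → ∃ λ y → take (suc k) xs ≡ take k xs ∷ʳ y
take-suc-∷ʳ zero    (x ∷ xs) _       = x , refl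
take-suc-∷ʳ (suc k) (x ∷ xs) (s≤s p) = map₂ (cong (x ∷_)) (take-suc-∷ʳ k xs p)

palindrome-inner : ∀ x y (mid : List A) → IsPalindrome (x ∷ mid ∷ʳ y) → IsPalindrome mid
palindrome-inner x y mid p = ∷ʳ-injectiveˡ (reverse mid) mid (∷-injectiveʳ reversed)
  where
    reversed : y ∷ (reverse mid ∷ʳ x) ≡ x ∷ (mid ∷ʳ y)
    reversed = trans (sym (trans (unfold-reverse x (mid ∷ʳ y)) (cong (_∷ʳ x) (reverse-++ mid (y ∷ []))))) p

palindromeAt-inner : ∀ (S : List A) q k → q + suc (suc k) ≤ length S →
                     PalindromeAt S q (suc (suc k)) → PalindromeAt S (suc q) k
palindromeAt-inner S q k bound p =
  subst (λ T → IsPalindrome (take k T)) (trans (drop-drop q 1 S) (cong (λ j → drop j S) (+-comm q 1)))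
    (inner (drop q S) (subst (suc (suc k) ≤_) (sym (length-drop q S)) (m+n≤o⇒m≤o∸n _ (subst (_≤ length S) (+-comm q _) bound))) p)
  where
    inner : ∀ xs → suc (suc k) ≤ length xs → IsPalindrome (take (suc (suc k)) xs) → IsPalindrome (take k (drop 1 xs))
    inner (x ∷ rest) bound′ p′ with take-suc-∷ʳ k rest (s≤s⁻¹ bound′)
    ... | y , e = palindrome-inner x y (take k rest) (subst IsPalindrome (cong (x ∷_) e) p′)

-- If the longest palindromic suffix of S[0..t+1] starts at q ≤ t - 1, stripping its ends
-- gives a palindromic suffix of S[0..t] starting at q + 1.
palSuffixStart-step : ∀ S t → suc t < length S → palSuffixStart S t ≤ suc (palSuffixStart S (suc t))
palSuffixStart-step S t t+1<n with t ≤? palSuffixStart S (suc t)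
... | yes t≤q = ≤-trans (palSuffixStart-≤ S t) (≤-trans t≤q (n≤1+n _))
... | no  t≰q = palSuffixStart-minimal S t (subst (PalindromeAt S (suc q)) (sym inner-length) inner) (≰⇒> t≰q)
  where
    q d : ℕ
    q = palSuffixStart S (suc t)
    d = proj₁ (m≤n⇒∃[o]m+o≡n (≰⇒> t≰q))
    t≡ : suc q + d ≡ t
    t≡ = proj₂ (m≤n⇒∃[o]m+o≡n (≰⇒> t≰q))
    t+2≡ : suc (suc t) ≡ q + suc (suc (suc d))
    t+2≡ = trans (cong (λ j → suc (suc j)) (sym t≡)) (solve 2 (λ q d → con 2 :+ (con 1 :+ q :+ d) := q :+ (con 3 :+ d)) refl q d)
    inner-length : suc t ∸ suc q ≡ suc d
    inner-length = trans (cong (_∸ q) (trans (sym t≡) (sym (+-suc q d)))) (m+n∸m≡n q (suc d))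
    inner : PalindromeAt S (suc q) (suc d)
    inner = palindromeAt-inner S q (suc d) (subst (_≤ length S) t+2≡ t+1<n)
              (subst (PalindromeAt S q) (trans (cong (_∸ q) t+2≡) (m+n∸m≡n q _)) (palSuffixStart-palindrome S (suc t)))

-- palSuffixStart S t ∷ … ∷ palSuffixStart S 1, newest first.
palSuffixStarts : List ℕ → ℕ → List ℕ
palSuffixStarts S zero    = []
palSuffixStarts S (suc t) = palSuffixStart S (suc t) ∷ palSuffixStarts S t

length-palSuffixStarts : ∀ S t → length (palSuffixStarts S t) ≡ t
length-palSuffixStarts S zero    = refl
length-palSuffixStarts S (suc t) = cong suc (length-palSuffixStarts S t)

palSuffixStarts-admissible : ∀ S t → t < length S → Admissible (palSuffixStarts S t)
palSuffixStarts-admissible S zero    _     = _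
palSuffixStarts-admissible S (suc t) t+1<n =
  palSuffixStarts-admissible S t (<-trans (n<1+n t) t+1<n) ,
  subst (palSuffixStart S (suc t) ≤_) (cong suc (sym (length-palSuffixStarts S t))) (palSuffixStart-≤ S (suc t)) ,
  previous t t+1<n
  where
    previous : ∀ t → suc t < length S → newest (palSuffixStarts S t) ≤ suc (palSuffixStart S (suc t))
    previous zero    _     = z≤n
    previous (suc t) t+2<n = palSuffixStart-step S (suc t) t+2<n

palSuffixStarts-injective : ∀ S S′ t → palSuffixStarts S t ≡ palSuffixStarts S′ t →
                            ∀ u → u ≤ t → palSuffixStart S u ≡ palSuffixStart S′ u
palSuffixStarts-injective S S′ t       e zero    _   = refl
palSuffixStarts-injective S S′ (suc t) e (suc u) u≤t with m≤n⇒m<n∨m≡n u≤t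
... | inj₂ refl = ∷-injectiveˡ e
... | inj₁ u<t  = palSuffixStarts-injective S S′ t (∷-injectiveʳ e) (suc u) (s≤s⁻¹ u<t)

manacher-determined : ∀ {S S′} → length S ≡ length S′ →
                      palSuffixStarts S (length S ∸ 1) ≡ palSuffixStarts S′ (length S ∸ 1) → manacher S ≡ manacher S′
manacher-determined {S} {S′} |S|≡ e =
  manacherArray-unique (manacherArray-transfer |S|≡ same {manacher S} (manacher-isManacherArrayOf S)) (manacher-isManacherArrayOf S′)
  where
    q≡ : ∀ t → t < length S → palSuffixStart S t ≡ palSuffixStart S′ t
    q≡ t t<n = palSuffixStarts-injective S S′ (length S ∸ 1) e t (m+n≤o⇒m≤o∸n t (subst (_≤ length S) (+-comm 1 t) t<n))
    same : SamePalindromes S S′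
    same = samePalindromes-inRange |S|≡ (palindromes-agree-upTo |S|≡ q≡ (length S) ≤-refl)

unique-⊆-length : ∀ {xs ys : List A} → Unique xs → (∀ {x} → x ∈ xs → x ∈ ys) → length xs ≤ length ys
unique-⊆-length {xs = []}     _            _  = z≤n
unique-⊆-length {xs = x ∷ xs} (x∉xs ∷ uxs) xs⊆ys with ∈-∃++ (xs⊆ys (here refl))
... | ys₁ , ys₂ , refl = begin
  suc (length xs)               ≤⟨ s≤s (unique-⊆-length uxs xs⊆ys₁ys₂) ⟩
  suc (length (ys₁ ++ ys₂))     ≡⟨ cong suc (length-++ ys₁) ⟩
  suc (length ys₁ + length ys₂) ≡⟨ sym (+-suc (length ys₁) (length ys₂)) ⟩
  length ys₁ + suc (length ys₂) ≡⟨ sym (length-++ ys₁) ⟩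
  length (ys₁ ++ x ∷ ys₂)       ∎
  where
    open ≤-Reasoning
    xs⊆ys₁ys₂ : ∀ {v} → v ∈ xs → v ∈ ys₁ ++ ys₂
    xs⊆ys₁ys₂ v∈xs with ∈-++⁻ ys₁ (xs⊆ys (there v∈xs))
    ... | inj₁ v∈ys₁          = ∈-++⁺ˡ v∈ys₁
    ... | inj₂ (here refl)    = ⊥-elim (All.lookup x∉xs v∈xs refl)
    ... | inj₂ (there v∈ys₂)  = ∈-++⁺ʳ ys₁ v∈ys₂

map-unique : ∀ (f : A → C) {xs} → Unique xs → (∀ {x y} → x ∈ xs → y ∈ xs → f x ≡ f y → x ≡ y) → Unique (map f xs)
map-unique f {[]}     _            _   = []
map-unique f {x ∷ xs} (x∉xs ∷ uxs) inj =
  All.map⁺ (All.tabulate λ y∈xs fx≡fy → All.lookup x∉xs y∈xs (inj (here refl) (there y∈xs) fx≡fy))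
  ∷ map-unique f uxs (λ x∈ y∈ → inj (there x∈) (there y∈))

injection-length-≤ : ∀ (f : A → C) {xs ys} → Unique xs → (∀ {x} → x ∈ xs → f x ∈ ys) →
                     (∀ {x y} → x ∈ xs → y ∈ xs → f x ≡ f y → x ≡ y) → length xs ≤ length ys
injection-length-≤ f {xs} {ys} uxs into inj =
  subst (_≤ length ys) (length-map f xs) (unique-⊆-length (map-unique f uxs inj) image⊆)
  where
    image⊆ : ∀ {y} → y ∈ map f xs → y ∈ ys
    image⊆ y∈ with ∈-map⁻ f y∈
    ... | x , x∈ , refl = into x∈

module _ (_≟_ : DecidableEquality C) (f : A → C) (default : A) where

  preimage : List A → C → A
  preimage []       y = default
  preimage (x ∷ xs) y with f x ≟ y
  ... | yes _ = x
  ... | no  _ = preimage xs y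

  preimage-correct : ∀ xs {y} → y ∈ map f xs → preimage xs y ∈ xs × f (preimage xs y) ≡ y
  preimage-correct (x ∷ xs) {y} y∈ with f x ≟ y
  ... | yes fx≡y = here refl , fx≡y
  ... | no  fx≢y with y∈
  ...   | here y≡fx = ⊥-elim (fx≢y (sym y≡fx))
  ...   | there y∈′ = map₁ there (preimage-correct xs y∈′)

wordTree : List ℕ → List Gene
wordTree S = encode (palSuffixStarts S (length S ∸ 1))

module _ (S : List ℕ) (|S|≥1 : 1 ≤ length S) where

  private
    t<|S| : length S ∸ 1 < length S
    t<|S| = ∸-monoʳ-< (s≤s z≤n) |S|≥1

  wordTree-isDuplicationTree : IsDuplicationTree (suc (length S)) (wordTree S)
  wordTree-isDuplicationTree =
    subst (λ m → IsDuplicationTree m (wordTree S))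
      (cong suc (trans (cong suc (length-palSuffixStarts S (length S ∸ 1))) (m+[n∸m]≡n |S|≥1)))
      (encode-isDuplicationTree (palSuffixStarts-admissible S (length S ∸ 1) t<|S|))

  wordTree-determines-manacher : ∀ {S′} → length S ≡ length S′ → wordTree S ≡ wordTree S′ → manacher S ≡ manacher S′
  wordTree-determines-manacher {S′} |S|≡ e = manacher-determined |S|≡ (encode-injective (admissible refl) (admissible |S|≡)
      (subst (λ m → wordTree S ≡ encode (palSuffixStarts S′ (m ∸ 1))) (sym |S|≡) e))
    where
      admissible : ∀ {T} → length S ≡ length T → Admissible (palSuffixStarts T (length S ∸ 1))
      admissible {T} e = palSuffixStarts-admissible T (length S ∸ 1) (subst (length S ∸ 1 <_) e t<|S|)

manacherArrays≤duplicationTrees : ∀ n → 1 ≤ n → length (manacherArrays n) ≤ length (duplicationTrees (suc n))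
manacherArrays≤duplicationTrees n n≥1 =
  injection-length-≤ (wordTree ∘ word) (deduplicate-! _≟ℕs_ _) wordTree∈ wordTree-injective
  where
    word : List ℕ → List ℕ
    word = preimage _≟ℕs_ manacher [] (words n n)

    word-correct : ∀ {M} → M ∈ manacherArrays n → word M ∈ words n n × manacher (word M) ≡ M
    word-correct M∈ = preimage-correct _≟ℕs_ manacher [] (words n n) (∈-deduplicate⁻ _≟ℕs_ _ M∈)

    |word| : ∀ {M} → M ∈ manacherArrays n → length (word M) ≡ n
    |word| M∈ = ∈-words⁻ n (proj₁ (word-correct M∈))

    wordTree∈ : ∀ {M} → M ∈ manacherArrays n → wordTree (word M) ∈ duplicationTrees (suc n)
    wordTree∈ {M} M∈ = ∈-duplicationTrees⁺ (subst (λ m → IsDuplicationTree (suc m) (wordTree (word M))) (|word| M∈)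
                         (wordTree-isDuplicationTree (word M) (subst (1 ≤_) (sym (|word| M∈)) n≥1)))

    wordTree-injective : ∀ {M M′} → M ∈ manacherArrays n → M′ ∈ manacherArrays n →
                         wordTree (word M) ≡ wordTree (word M′) → M ≡ M′
    wordTree-injective {M} {M′} M∈ M′∈ e = begin
      M                    ≡⟨ sym (proj₂ (word-correct M∈)) ⟩
      manacher (word M)    ≡⟨ wordTree-determines-manacher (word M) (subst (1 ≤_) (sym (|word| M∈)) n≥1)
                                (trans (|word| M∈) (sym (|word| M′∈))) e ⟩
      manacher (word M′)   ≡⟨ proj₂ (word-correct M′∈) ⟩
      M′                   ∎
      where open ≡-Reasoning

theorem1 : (n : ℕ) → 1 ≤ n →
    Σ ℕ λ ρ → Σ ℕ λ r →
      HasSize (IsManacherArray n) ρ × HasSize (IsDuplicationTree (suc n)) r × (ρ ≤ r)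
theorem1 n n≥1 =
  length (manacherArrays n) , length (duplicationTrees (suc n)) ,
  manacherArrays-size n , duplicationTrees-size (suc n) , manacherArrays≤duplicationTrees n n≥1
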